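{- Let $\mathfrak{n}=\mathfrak{p}_1\cdots\mathfrak{p}_r$ with distinct monic irreducible $\mathfrak{p}_i\in A$, let $\zeta_i\in\mathbb{C}_\infty$ be a root of $\mathfrak{p}_i$, and let $\chi_1=\prod_{i=1}^r\chi_{\zeta_i}^{j_i}$, $\chi_2=\prod_{i=1}^r\chi_{\zeta_i}^{k_i}$ with $1\le k_i,j_i<|\mathfrak{p}_i|-1$ for all $i$. For each $\delta\in A$ with $|\delta|<|\mathfrak{n}|$, \[(\chi_1*\chi_2)(\delta):=\sum_{|a|<|\mathfrak{n}|}\chi_1(a)\chi_2(\delta-a)=(\chi_1\chi_2)(\delta)\cdot\prod_{i=1}^r(-1)^{1-j_i}\binom{k_i}{|\mathfrak{p}_i|-1-j_i},\] where $\chi_1\chi_2:=\prod_{i=1}^r\chi_{\zeta_i}^{\overline{j_i+k_i}}$ with $\overline{j_i+k_i}$ the residue of $j_i+k_i$ in $\{0,1,\dots,|\mathfrak{p}_i|-2\}$.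
   Context: $\mathbb{F}_q$ finite field with $q$ elements of characteristic $p$, $A=\mathbb{F}_q[\theta]$, $\mathbb{C}_\infty$ the completion of an algebraic closure of $\mathbb{F}_q((1/\theta))$. For $b\in A$, $|b|=q^{\deg b}$ ($|0|=0$), so sums over $|a|<|\mathfrak{n}|$ run over all polynomials of degree $<\deg\mathfrak{n}$, including $0$. For a root $\zeta$ of a monic irreducible, $\chi_\zeta:A\to\mathbb{C}_\infty$ is the $\mathbb{F}_q$-algebra map $\theta\mapsto\zeta$, and $\chi_\zeta^e(a)=a(\zeta)^e$ with the convention $0^0=1$. Binomial coefficients are integers reduced mod $p$, with $\binom{x}{y}=0$ when $y>x$. -}

module Defs where

open import Level using (Level; _⊔_)
open import Algebra.Bundles using (CommutativeRing)
open import Algebra.Morphism.Structures using (module RingMorphisms)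
open import Data.List using (List; []; _∷_; length; map; concatMap; foldr; _++_; [_])
open import Data.List.Relation.Unary.Any using (Any)
open import Data.List.Relation.Unary.AllPairs using (AllPairs)
open import Data.List.Relation.Binary.Pointwise using (Pointwise)
open import Data.Vec using (Vec; []; _∷_; zipWith)
open import Data.Fin using (Fin; zero; suc)
open import Data.Nat using (ℕ; zero; suc; _^_; _≤_)
open import Data.Product using (_×_; ∃; ∃₂)
open import Relation.Nullary using (¬_)

module _ {c ℓ} (F : CommutativeRing c ℓ) where
  open CommutativeRing F using (Carrier; _≈_; _+_; _*_; _-_; 0#; 1#)

  IsField : Set (c ⊔ ℓ)
  IsField = (¬ (1# ≈ 0#)) × (∀ x → ¬ (x ≈ 0#) → ∃ λ y → x * y ≈ 1#)

  -- es lists every element of F exactly once (up to ≈); then q = length es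
  IsEnumeration : List Carrier → Set (c ⊔ ℓ)
  IsEnumeration es = (∀ x → Any (x ≈_) es) × AllPairs (λ x y → ¬ (x ≈ y)) es

  -- polynomials as coefficient lists, lowest degree first
  addP : List Carrier → List Carrier → List Carrier
  addP [] g = g
  addP (a ∷ f) [] = a ∷ f
  addP (a ∷ f) (b ∷ g) = (a + b) ∷ addP f g

  mulP : List Carrier → List Carrier → List Carrier
  mulP [] g = []
  mulP (a ∷ f) g = addP (map (a *_) g) (0# ∷ mulP f g)

  -- the monic polynomial θ^(length cs) + Σ_m cs[m] θ^m, given by its
  -- non-leading coefficients cs; its degree is length cs
  monic : List Carrier → List Carrier
  monic cs = cs ++ [ 1# ]

  -- equality of coefficient lists (used on monic polynomials, whose
  -- representation is canonical)
  _≈P_ : List Carrier → List Carrier → Set (c ⊔ ℓ)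
  _≈P_ = Pointwise _≈_

  MonicIrreducible : List Carrier → Set (c ⊔ ℓ)
  MonicIrreducible cs =
    (1 ≤ length cs) ×
    (¬ ∃₂ λ f g → (1 ≤ length f) × (1 ≤ length g) ×
                  (mulP (monic f) (monic g) ≈P monic cs))

  -- all polynomials of degree < n, i.e. all coefficient vectors of length n
  allPolys : List Carrier → (n : ℕ) → List (Vec Carrier n)
  allPolys es zero = [ [] ]
  allPolys es (suc n) = concatMap (λ x → map (x ∷_) (allPolys es n)) es

  subV : ∀ {n} → Vec Carrier n → Vec Carrier n → Vec Carrier n
  subV = zipWith (λ x y → x - y)

sumℕ : (r : ℕ) → (Fin r → ℕ) → ℕ
sumℕ zero f = 0
sumℕ (suc r) f = f zero Data.Nat.+ sumℕ r (λ i → f (suc i))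

module Eval {c ℓ c' ℓ'} (F : CommutativeRing c ℓ) (K : CommutativeRing c' ℓ')
            (φ : CommutativeRing.Carrier F → CommutativeRing.Carrier K) where
  private
    module F = CommutativeRing F
  open CommutativeRing K using (Carrier; _+_; _*_; 0#; 1#)

  -- x ^ e with x ^ 0 = 1 (so 0 ^ 0 = 1)
  pow : Carrier → ℕ → Carrier
  pow x zero = 1#
  pow x (suc e) = x * pow x e

  -- image of a natural number (hence reduced mod the characteristic)
  natK : ℕ → Carrier
  natK zero = 0#
  natK (suc n) = 1# + natK n

  prodFin : (r : ℕ) → (Fin r → Carrier) → Carrier
  prodFin zero f = 1#
  prodFin (suc r) f = f zero * prodFin r (λ i → f (suc i))

  sumL : List Carrier → Carrier
  sumL = foldr _+_ 0#

  evalL : List F.Carrier → Carrier → Carrier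
  evalL [] z = 0#
  evalL (a ∷ as) z = φ a + z * evalL as z

  evalV : ∀ {n} → Vec F.Carrier n → Carrier → Carrier
  evalV [] z = 0#
  evalV (a ∷ as) z = φ a + z * evalV as z

  χ : (r : ℕ) → (Fin r → Carrier) → (Fin r → ℕ) → ∀ {n} → Vec F.Carrier n → Carrier
  χ r ζ e a = prodFin r (λ i → pow (evalV a (ζ i)) (e i))

{-# OPTIONS --safe #-}
module Submission where

-- Write a polynomial of degree < deg 𝔫 as a = u + 𝔭₁ w with deg u < deg 𝔭₁. Then a(ζ₁) = u(ζ₁),
-- while for i > 1, a(ζᵢ) = u(ζᵢ) + 𝔭₁(ζᵢ) w(ζᵢ) with 𝔭₁(ζᵢ) ≠ 0, so the sum over w is an affine
-- change of variables in the remaining primes; by induction the convolution becomes a product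
-- over i of sums Σ_v v(ζᵢ)^j (δ(ζᵢ) − v(ζᵢ))^k over the residues v modulo 𝔭ᵢ. Evaluation at ζᵢ
-- identifies these residues with a field of Q = q^(deg 𝔭ᵢ) elements, in which Σ_v v^e is −1 for
-- e = Q − 1 and 0 for the other 0 < e < 2(Q − 1). Expanding (δ(ζᵢ) − v)^k binomially, only the
-- term in v^(Q−1) survives, giving δ(ζᵢ)^((j+k) mod (Q−1)) (−1)^(j−1) binom(k, Q−1−j).

open import Level using (Level)
open import Algebra.Bundles using (CommutativeRing; CommutativeMonoid; RawRing)
open import Algebra.Morphism.Structures using (module RingMorphisms)
open import Data.Empty using (⊥; ⊥-elim)
open import Function using (_∘_)
open import Data.Fin using (Fin; toℕ; fromℕ<; punchIn) renaming (zero to fzero; suc to fsuc)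
open import Data.Fin.Patterns using (0F; 1F; 2F; 3F)
open import Data.Fin.Properties using (punchInᵢ≢i; toℕ<n; toℕ-injective; toℕ-fromℕ<) renaming (suc-injective to fsuc-injective)
open import Data.List using (List; []; _∷_; [_]; length; map; foldr; concatMap; _++_; replicate; zipWith; initLast; _∷ʳ′_)
import Data.List.Properties as List
import Data.List.Relation.Binary.Pointwise as ListPointwise
open import Data.List.Relation.Unary.All as All using (All; []; _∷_)
import Data.List.Relation.Unary.All.Properties as All
open import Data.List.Relation.Unary.AllPairs as AllPairs using (AllPairs; []; _∷_)
import Data.List.Relation.Unary.AllPairs.Properties as AllPairs
open import Data.List.Relation.Unary.Any as Any using (Any; here; there; _─_)
import Data.List.Relation.Unary.Any.Properties as Any
open import Data.Maybe using (Maybe; just; nothing)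
open import Data.Nat as ℕ using (ℕ; zero; suc; _≤_; _<_; _∸_; _⊔_; z≤n; s≤s)
import Data.Nat.Properties as ℕ
open import Data.Nat.Combinatorics using (_C_; k>n⇒nCk≡0)
open import Data.Nat.DivMod using (_%_; [m+n]%n≡m%n; m≤n⇒m%n≡m)
open import Data.Product using (_×_; _,_; proj₁; proj₂; ∃; ∃₂)
open import Data.Vec as Vec using (Vec; []; _∷_)
open import Data.Vec.Properties using (length-toList)
import Data.Vec.Relation.Binary.Pointwise.Inductive as Pointwise
open import Relation.Binary.Bundles using (Setoid)
open import Relation.Binary.Definitions using (tri<; tri≈; tri>)
open import Relation.Binary.PropositionalEquality as ≡ using (_≡_; _≢_)
open import Relation.Nullary using (¬_; Dec; yes; no)
open import Defs

module CommutativeRingSolver {c ℓ} (R : CommutativeRing c ℓ) where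
  open CommutativeRing R
  open import Relation.Binary.Reasoning.Setoid setoid
  open import Algebra.Properties.Ring ring
    using (-‿involutive; -‿distribˡ-*; -‿distribʳ-*; -0#≈0#; -‿anti-homo-+)
  open import Algebra.Properties.Semiring.Mult semiring
    using (×-homo-+; ×1-homo-*) renaming (_×_ to _·_)
  open import Algebra.Solver.Ring.AlmostCommutativeRing
    using (fromCommutativeRing; _-Raw-AlmostCommutative⟶_)

  -- Integer coefficients as pairs (a , b) standing for a − b: unlike R, they
  -- have the (weakly) decidable equality that the solver needs to normalise.
  private
    Coefficients : RawRing _ _
    Coefficients = record
      { Carrier = ℕ × ℕ
      ; _≈_ = _≡_
      ; _+_ = λ (a , b) (a′ , b′) → (a ℕ.+ a′ , b ℕ.+ b′)
      ; _*_ = λ (a , b) (a′ , b′) → (a ℕ.* a′ ℕ.+ b ℕ.* b′ , a ℕ.* b′ ℕ.+ b ℕ.* a′)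
      ; -_ = λ (a , b) → (b , a)
      ; 0# = (0 , 0)
      ; 1# = (1 , 0)
      }

    ⟦_⟧ : ℕ × ℕ → Carrier
    ⟦ a , b ⟧ = a · 1# - b · 1#

    [x-y]+[u-v]≈[x+u]-[y+v] : ∀ x y u v → (x - y) + (u - v) ≈ (x + u) - (y + v)
    [x-y]+[u-v]≈[x+u]-[y+v] x y u v = begin
      (x - y) + (u - v)   ≈⟨ +-assoc _ _ _ ⟩
      x + (- y + (u - v)) ≈⟨ +-congˡ (trans (sym (+-assoc _ _ _)) (trans (+-congʳ (+-comm _ _)) (+-assoc _ _ _))) ⟩
      x + (u + (- y - v)) ≈⟨ sym (+-assoc _ _ _) ⟩
      (x + u) + (- y - v) ≈⟨ +-congˡ (sym (-‿anti-homo-+ v y)) ⟩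
      (x + u) - (v + y)   ≈⟨ +-congˡ (-‿cong (+-comm _ _)) ⟩
      (x + u) - (y + v)   ∎

    [x-y]*[u-v]≈[xu+yv]-[xv+yu] : ∀ x y u v → (x - y) * (u - v) ≈ (x * u + y * v) - (x * v + y * u)
    [x-y]*[u-v]≈[xu+yv]-[xv+yu] x y u v = begin
      (x - y) * (u - v)                             ≈⟨ distribʳ _ _ _ ⟩
      x * (u - v) + (- y) * (u - v)                 ≈⟨ +-cong (distribˡ _ _ _) (distribˡ _ _ _) ⟩
      (x * u + x * - v) + ((- y) * u + (- y) * - v) ≈⟨ +-cong (+-congˡ (sym (-‿distribʳ-* _ _))) (+-cong (sym (-‿distribˡ-* _ _)) -y*-v≈yv) ⟩
      (x * u - x * v) + (- (y * u) + y * v)         ≈⟨ +-congˡ (+-comm _ _) ⟩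
      (x * u - x * v) + (y * v - y * u)             ≈⟨ [x-y]+[u-v]≈[x+u]-[y+v] _ _ _ _ ⟩
      (x * u + y * v) - (x * v + y * u)             ∎
      where
      -y*-v≈yv : (- y) * (- v) ≈ y * v
      -y*-v≈yv = trans (sym (-‿distribˡ-* _ _)) (trans (-‿cong (sym (-‿distribʳ-* _ _))) (-‿involutive _))

    ·1-homo-+ : ∀ m n → (m ℕ.+ n) · 1# ≈ m · 1# + n · 1#
    ·1-homo-+ m n = ×-homo-+ 1# m n

    interpretation : Coefficients -Raw-AlmostCommutative⟶ fromCommutativeRing R
    interpretation = record
      { ⟦_⟧ = ⟦_⟧
      ; +-homo = λ (a , b) (a′ , b′) →
          trans (+-cong (·1-homo-+ a a′) (-‿cong (·1-homo-+ b b′))) (sym ([x-y]+[u-v]≈[x+u]-[y+v] _ _ _ _))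
      ; *-homo = λ (a , b) (a′ , b′) →
          trans (+-cong (trans (·1-homo-+ (a ℕ.* a′) (b ℕ.* b′)) (+-cong (×1-homo-* a a′) (×1-homo-* b b′)))
                        (-‿cong (trans (·1-homo-+ (a ℕ.* b′) (b ℕ.* a′)) (+-cong (×1-homo-* a b′) (×1-homo-* b a′)))))
                (sym ([x-y]*[u-v]≈[xu+yv]-[xv+yu] _ _ _ _))
      ; -‿homo = λ _ → sym (trans (-‿anti-homo-+ _ _) (+-congʳ (-‿involutive _)))
      ; 0-homo = trans (+-congˡ -0#≈0#) (+-identityʳ _)
      ; 1-homo = trans (+-congˡ -0#≈0#) (trans (+-identityʳ _) (+-identityʳ _))
      }

    ⟦⟧-cong : ∀ a b a′ b′ → a ℕ.+ b′ ≡ a′ ℕ.+ b → ⟦ a , b ⟧ ≈ ⟦ a′ , b′ ⟧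
    ⟦⟧-cong a b a′ b′ eq = begin
      a · 1# - b · 1#
        ≈⟨ sym (+-identityʳ _) ⟩
      (a · 1# - b · 1#) + 0#
        ≈⟨ +-congˡ (sym (-‿inverseʳ _)) ⟩
      (a · 1# - b · 1#) + (b′ · 1# - b′ · 1#)
        ≈⟨ [x-y]+[u-v]≈[x+u]-[y+v] _ _ _ _ ⟩
      (a · 1# + b′ · 1#) - (b · 1# + b′ · 1#)
        ≈⟨ +-cong (trans (sym (·1-homo-+ a b′)) (trans (reflexive (≡.cong (_· 1#) eq)) (·1-homo-+ a′ b))) (-‿cong (+-comm _ _)) ⟩
      (a′ · 1# + b · 1#) - (b′ · 1# + b · 1#)
        ≈⟨ sym ([x-y]+[u-v]≈[x+u]-[y+v] _ _ _ _) ⟩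
      (a′ · 1# - b′ · 1#) + (b · 1# - b · 1#)
        ≈⟨ +-congˡ (-‿inverseʳ _) ⟩
      (a′ · 1# - b′ · 1#) + 0#
        ≈⟨ +-identityʳ _ ⟩
      a′ · 1# - b′ · 1#
        ∎

    _≟ᶜ_ : ∀ x y → Maybe (⟦ x ⟧ ≈ ⟦ y ⟧)
    (a , b) ≟ᶜ (a′ , b′) with a ℕ.+ b′ ℕ.≟ a′ ℕ.+ b
    ... | yes eq = just (⟦⟧-cong a b a′ b′ eq)
    ... | no _ = nothing

  open import Algebra.Solver.Ring Coefficients (fromCommutativeRing R) interpretation _≟ᶜ_ public
    using (solve; _:=_; _:+_; _:*_; _:-_; :-_)

module FieldProperties {c ℓ} (R : CommutativeRing c ℓ) (isField : IsField R) where
  open CommutativeRing R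
  open CommutativeRingSolver R
  open import Algebra.Properties.Ring ring using (x∙y⁻¹≈ε⇒x≈y)
  open import Relation.Binary.Reasoning.Setoid setoid

  1≉0 : ¬ 1# ≈ 0#
  1≉0 = proj₁ isField

  *-cancelˡ : ∀ {x y z} → ¬ x ≈ 0# → x * y ≈ x * z → y ≈ z
  *-cancelˡ {x} {y} {z} x≉0 xy≈xz with proj₂ isField x x≉0
  ... | x⁻¹ , xx⁻¹≈1 = begin
    y             ≈⟨ sym (*-identityˡ y) ⟩
    1# * y        ≈⟨ *-congʳ (sym x⁻¹x≈1) ⟩
    x⁻¹ * x * y   ≈⟨ *-assoc _ _ _ ⟩
    x⁻¹ * (x * y) ≈⟨ *-congˡ xy≈xz ⟩
    x⁻¹ * (x * z) ≈⟨ sym (*-assoc _ _ _) ⟩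
    x⁻¹ * x * z   ≈⟨ *-congʳ x⁻¹x≈1 ⟩
    1# * z        ≈⟨ *-identityˡ z ⟩
    z             ∎
    where
    x⁻¹x≈1 : x⁻¹ * x ≈ 1#
    x⁻¹x≈1 = trans (*-comm _ _) xx⁻¹≈1

  x*y≉0 : ∀ {x y} → ¬ x ≈ 0# → ¬ y ≈ 0# → ¬ x * y ≈ 0#
  x*y≉0 {x} x≉0 y≉0 xy≈0 = y≉0 (*-cancelˡ x≉0 (trans xy≈0 (sym (zeroʳ x))))

  x≉1∧xy≈y⇒y≈0 : ∀ {x y} → ¬ x ≈ 1# → x * y ≈ y → y ≈ 0#
  x≉1∧xy≈y⇒y≈0 {x} {y} x≉1 xy≈y = *-cancelˡ x-1≉0 (begin
    (x - 1#) * y  ≈⟨ solve 3 (λ x y o → (x :- o) :* y := x :* y :- y :* o) refl x y 1# ⟩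
    x * y - y * 1# ≈⟨ +-cong xy≈y (-‿cong (*-identityʳ y)) ⟩
    y - y          ≈⟨ -‿inverseʳ y ⟩
    0#             ≈⟨ sym (zeroʳ _) ⟩
    (x - 1#) * 0#  ∎)
    where
    x-1≉0 : ¬ x - 1# ≈ 0#
    x-1≉0 x-1≈0 = x≉1 (x∙y⁻¹≈ε⇒x≈y x 1# x-1≈0)

module PolynomialRoots {c ℓ} (K : CommutativeRing c ℓ) (K-isField : IsField K) where
  open CommutativeRing K
  open CommutativeRingSolver K
  open FieldProperties K K-isField
  open import Algebra.Properties.CommutativeSemiring.Exp commutativeSemiring using (_^_)
  open import Algebra.Properties.Ring ring using (x∙y⁻¹≈ε⇒x≈y)
  open import Relation.Binary.Reasoning.Setoid setoid

  horner : List Carrier → Carrier → Carrier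
  horner [] z = 0#
  horner (a ∷ as) z = a + z * horner as z

  monicAt : List Carrier → Carrier → Carrier
  monicAt as z = horner as z + z ^ length as

  monicAt-∷ : ∀ a as z → monicAt (a ∷ as) z ≈ a + z * monicAt as z
  monicAt-∷ a as z = solve 4 (λ a z h p → a :+ z :* h :+ z :* p := a :+ z :* (h :+ p)) refl a z (horner as z) (z ^ length as)

  quotientBy : Carrier → List Carrier → List Carrier
  quotientBy x [] = []
  quotientBy x (a ∷ as) = monicAt (a ∷ as) x ∷ quotientBy x as

  length-quotientBy : ∀ x as → length (quotientBy x as) ≡ length as
  length-quotientBy x [] = ≡.refl
  length-quotientBy x (a ∷ as) = ≡.cong suc (length-quotientBy x as)

  synthetic-division : ∀ x a as z → monicAt (a ∷ as) z ≈ (z - x) * monicAt (quotientBy x as) z + monicAt (a ∷ as) x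
  synthetic-division x a [] z = begin
    a + z * 0# + z * 1#                           ≈⟨ linear z ⟩
    a + z                                         ≈⟨ solve 3 (λ x a z → a :+ z := (z :- x) :+ (a :+ x)) refl x a z ⟩
    (z - x) + (a + x)                             ≈⟨ +-cong (sym (trans (*-congˡ (+-identityˡ 1#)) (*-identityʳ _))) (sym (linear x)) ⟩
    (z - x) * (0# + 1#) + (a + x * 0# + x * 1#)   ∎
    where
    linear : ∀ y → a + y * 0# + y * 1# ≈ a + y
    linear y = +-cong (trans (+-congˡ (zeroʳ y)) (+-identityʳ a)) (*-identityʳ y)
  synthetic-division x a (b ∷ as) z = begin
    monicAt (a ∷ b ∷ as) z
      ≈⟨ monicAt-∷ a (b ∷ as) z ⟩
    a + z * monicAt (b ∷ as) z
      ≈⟨ +-congˡ (*-congˡ (synthetic-division x b as z)) ⟩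
    a + z * ((z - x) * Q + B)
      ≈⟨ solve 5 (λ a z x Q B → a :+ z :* ((z :- x) :* Q :+ B) := (z :- x) :* (B :+ z :* Q) :+ (a :+ x :* B)) refl a z x Q B ⟩
    (z - x) * (B + z * Q) + (a + x * B)
      ≈⟨ +-cong (*-congˡ (sym (monicAt-∷ B (quotientBy x as) z))) (sym (monicAt-∷ a (b ∷ as) x)) ⟩
    (z - x) * monicAt (quotientBy x (b ∷ as)) z + monicAt (a ∷ b ∷ as) x
      ∎
    where
    Q B : Carrier
    Q = monicAt (quotientBy x as) z
    B = monicAt (b ∷ as) x

  root-bound : ∀ as xs → AllPairs (λ x y → ¬ x ≈ y) xs → All (λ x → monicAt as x ≈ 0#) xs → length xs ≤ length as
  root-bound as [] _ _ = z≤n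
  root-bound [] (x ∷ xs) _ (1≈0 ∷ _) = ⊥-elim (1≉0 (trans (sym (+-identityˡ 1#)) 1≈0))
  root-bound (a ∷ as) (x ∷ xs) (x≉xs ∷ distinct) (x-root ∷ roots) =
    s≤s (≡.subst (length xs ≤_) (length-quotientBy x as) (root-bound (quotientBy x as) xs distinct (All.zipWith quotient-root (x≉xs , roots))))
    where
    quotient-root : ∀ {y} → ¬ x ≈ y × monicAt (a ∷ as) y ≈ 0# → monicAt (quotientBy x as) y ≈ 0#
    quotient-root {y} (x≉y , y-root) = *-cancelˡ y-x≉0 (begin
      (y - x) * monicAt (quotientBy x as) y                        ≈⟨ sym (+-identityʳ _) ⟩
      (y - x) * monicAt (quotientBy x as) y + 0#                   ≈⟨ +-congˡ (sym x-root) ⟩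
      (y - x) * monicAt (quotientBy x as) y + monicAt (a ∷ as) x   ≈⟨ sym (synthetic-division x a as y) ⟩
      monicAt (a ∷ as) y                                           ≈⟨ y-root ⟩
      0#                                                           ≈⟨ sym (zeroʳ _) ⟩
      (y - x) * 0#                                                 ∎)
      where
      y-x≉0 : ¬ y - x ≈ 0#
      y-x≉0 y-x≈0 = x≉y (sym (x∙y⁻¹≈ε⇒x≈y y x y-x≈0))

  roots-of-unity-bound : ∀ e xs → AllPairs (λ x y → ¬ x ≈ y) xs → All (λ x → x ^ suc e ≈ 1#) xs → length xs ≤ suc e
  roots-of-unity-bound e xs distinct unities =
    ≡.subst (length xs ≤_) (≡.cong suc (List.length-replicate e))
      (root-bound (- 1# ∷ replicate e 0#) xs distinct (All.map root unities))
    where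
    horner-zeros : ∀ n z → horner (replicate n 0#) z ≈ 0#
    horner-zeros zero z = refl
    horner-zeros (suc n) z = trans (+-congˡ (trans (*-congˡ (horner-zeros n z)) (zeroʳ z))) (+-identityˡ 0#)
    root : ∀ {x} → x ^ suc e ≈ 1# → monicAt (- 1# ∷ replicate e 0#) x ≈ 0#
    root {x} x^e+1≈1 = begin
      (- 1# + x * horner (replicate e 0#) x) + x ^ suc (length (replicate e 0#))
        ≈⟨ +-cong (trans (+-congˡ (trans (*-congˡ (horner-zeros e x)) (zeroʳ x))) (+-identityʳ _))
                  (reflexive (≡.cong (λ n → x ^ suc n) (List.length-replicate e))) ⟩
      - 1# + x ^ suc e ≈⟨ +-congˡ x^e+1≈1 ⟩
      - 1# + 1#        ≈⟨ -‿inverseˡ 1# ⟩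
      0#               ∎

module MinusOnePowers {c ℓ} (R : CommutativeRing c ℓ) where
  open CommutativeRing R hiding (zero)
  open import Algebra.Properties.CommutativeSemiring.Exp commutativeSemiring using (_^_; ^-homo-*; ^-distrib-*; ^-congˡ)
  open import Algebra.Properties.Ring ring using (-‿distribˡ-*; -‿involutive)
  open import Relation.Binary.Reasoning.Setoid setoid

  1^n≈1 : ∀ n → 1# ^ n ≈ 1#
  1^n≈1 zero = refl
  1^n≈1 (suc n) = trans (*-identityˡ _) (1^n≈1 n)

  -1^n*-1^n≈1 : ∀ n → (- 1#) ^ n * (- 1#) ^ n ≈ 1#
  -1^n*-1^n≈1 n = trans (sym (^-distrib-* (- 1#) (- 1#) n))
    (trans (^-congˡ n (trans (sym (-‿distribˡ-* 1# (- 1#))) (trans (-‿cong (*-identityˡ _)) (-‿involutive 1#)))) (1^n≈1 n))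

  -1^m*-1≈-1^[j∸1] : ∀ Q → (- 1#) ^ Q ≈ 1# → ∀ j m → 1 ≤ j → j ℕ.+ m ≡ Q → (- 1#) ^ m * - 1# ≈ (- 1#) ^ (j ∸ 1)
  -1^m*-1≈-1^[j∸1] Q -1^Q≈1 (suc j) m _ 1+j+m≡Q = begin
    (- 1#) ^ m * - 1#
      ≈⟨ *-comm _ _ ⟩
    (- 1#) ^ suc m
      ≈⟨ sym (*-identityʳ _) ⟩
    (- 1#) ^ suc m * 1#
      ≈⟨ *-congˡ (sym (-1^n*-1^n≈1 j)) ⟩
    (- 1#) ^ suc m * ((- 1#) ^ j * (- 1#) ^ j)
      ≈⟨ sym (*-assoc _ _ _) ⟩
    (- 1#) ^ suc m * (- 1#) ^ j * (- 1#) ^ j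
      ≈⟨ *-congʳ (sym (^-homo-* (- 1#) (suc m) j)) ⟩
    (- 1#) ^ (suc m ℕ.+ j) * (- 1#) ^ j
      ≡⟨ ≡.cong (λ n → (- 1#) ^ n * (- 1#) ^ j) (≡.trans (ℕ.+-comm (suc m) j) (≡.trans (ℕ.+-suc j m) 1+j+m≡Q)) ⟩
    (- 1#) ^ Q * (- 1#) ^ j
      ≈⟨ trans (*-congʳ -1^Q≈1) (*-identityˡ _) ⟩
    (- 1#) ^ j
      ∎

module ListSum {c ℓ} (R : CommutativeRing c ℓ) where
  open CommutativeRing R
  open CommutativeRingSolver R
  open import Algebra.Properties.Semiring.Mult semiring using () renaming (_×_ to _·_)
  open import Algebra.Properties.Semiring.Sum semiring using (sum; sum-remove; sum-cong-≋; sum-replicate-zero)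

  private variable
    a b : Level
    A : Set a
    B : Set b

  Σ : List A → (A → Carrier) → Carrier
  Σ xs f = foldr _+_ 0# (map f xs)

  Σ-cong : ∀ (xs : List A) {f g : A → Carrier} → (∀ x → f x ≈ g x) → Σ xs f ≈ Σ xs g
  Σ-cong [] f≈g = refl
  Σ-cong (x ∷ xs) f≈g = +-cong (f≈g x) (Σ-cong xs f≈g)

  Σ-++ : ∀ (xs ys : List A) f → Σ (xs ++ ys) f ≈ Σ xs f + Σ ys f
  Σ-++ [] ys f = sym (+-identityˡ _)
  Σ-++ (x ∷ xs) ys f = trans (+-congˡ (Σ-++ xs ys f)) (sym (+-assoc _ _ _))

  Σ-map : ∀ (xs : List A) (g : A → B) f → Σ (map g xs) f ≈ Σ xs (λ x → f (g x))
  Σ-map xs g f = reflexive (≡.cong (foldr _+_ 0#) (≡.sym (List.map-∘ xs)))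

  Σ-concatMap : ∀ (xs : List A) (g : A → List B) f →
                Σ (concatMap g xs) f ≈ Σ xs (λ x → Σ (g x) f)
  Σ-concatMap [] g f = refl
  Σ-concatMap (x ∷ xs) g f = trans (Σ-++ (g x) (concatMap g xs) f) (+-congˡ (Σ-concatMap xs g f))

  Σ-distrib-+ : ∀ (xs : List A) f g → Σ xs (λ x → f x + g x) ≈ Σ xs f + Σ xs g
  Σ-distrib-+ [] f g = sym (+-identityˡ _)
  Σ-distrib-+ (x ∷ xs) f g = trans (+-congˡ (Σ-distrib-+ xs f g))
    (solve 4 (λ a b c d → (a :+ b) :+ (c :+ d) := (a :+ c) :+ (b :+ d)) refl _ _ _ _)

  *-distribˡ-Σ : ∀ k (xs : List A) f → k * Σ xs f ≈ Σ xs (λ x → k * f x)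
  *-distribˡ-Σ k [] f = zeroʳ k
  *-distribˡ-Σ k (x ∷ xs) f = trans (distribˡ _ _ _) (+-congˡ (*-distribˡ-Σ k xs f))

  *-distribʳ-Σ : ∀ k (xs : List A) f → Σ xs f * k ≈ Σ xs (λ x → f x * k)
  *-distribʳ-Σ k xs f = trans (*-comm _ _) (trans (*-distribˡ-Σ k xs f) (Σ-cong xs (λ _ → *-comm _ _)))

  Σ-zero : ∀ (xs : List A) {f} → (∀ x → f x ≈ 0#) → Σ xs f ≈ 0#
  Σ-zero [] f≈0 = refl
  Σ-zero (x ∷ xs) f≈0 = trans (+-cong (f≈0 x) (Σ-zero xs f≈0)) (+-identityˡ _)

  Σ-const : ∀ (xs : List A) k → Σ xs (λ _ → k) ≈ length xs · k
  Σ-const [] k = refl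
  Σ-const (x ∷ xs) k = +-congˡ (Σ-const xs k)

  Σ-comm : ∀ (xs : List A) (ys : List B) (f : A → B → Carrier) →
           Σ xs (λ x → Σ ys (f x)) ≈ Σ ys (λ y → Σ xs (λ x → f x y))
  Σ-comm [] ys f = sym (Σ-zero ys (λ _ → refl))
  Σ-comm (x ∷ xs) ys f = trans (+-congˡ (Σ-comm xs ys f)) (sym (Σ-distrib-+ ys (f x) _))

  Σ-sum-comm : ∀ {n} (xs : List A) (f : A → Fin n → Carrier) →
               Σ xs (λ x → sum (f x)) ≈ sum (λ i → Σ xs (λ x → f x i))
  Σ-sum-comm {n = zero} xs f = Σ-zero xs (λ _ → refl)
  Σ-sum-comm {n = suc n} xs f = trans (Σ-distrib-+ xs (λ x → f x fzero) _)
                                  (+-congˡ (Σ-sum-comm xs (λ x i → f x (fsuc i))))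

  sum-zero : ∀ {n} (f : Fin n → Carrier) → (∀ i → f i ≈ 0#) → sum f ≈ 0#
  sum-zero {n} f f≈0 = trans (sum-cong-≋ f≈0) (sum-replicate-zero n)

  sum-single : ∀ {n} (f : Fin (suc n) → Carrier) i → (∀ j → j ≢ i → f j ≈ 0#) → sum f ≈ f i
  sum-single f i others≈0 = trans (sum-remove f)
    (trans (+-congˡ (sum-zero _ (λ j → others≈0 (punchIn i j) (punchInᵢ≢i i j)))) (+-identityʳ _))

module Reindexing {a ℓa m ℓm} (S : Setoid a ℓa) (M : CommutativeMonoid m ℓm) where
  open Setoid S using () renaming (Carrier to A; _≈_ to _≃_)
  private module S = Setoid S
  open CommutativeMonoid M
  open import Relation.Binary.Reasoning.Setoid setoid
  open import Data.List.Membership.Setoid S using (_∈_)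

  fold : List A → (A → Carrier) → Carrier
  fold xs f = foldr _∙_ ε (map f xs)

  Distinct : List A → Set _
  Distinct = AllPairs (λ x y → ¬ x ≃ y)

  fold-─ : ∀ f {x ys} (p : x ∈ ys) → fold ys f ≈ f (Any.lookup p) ∙ fold (ys ─ p) f
  fold-─ f (here _) = refl
  fold-─ f {ys = y ∷ ys} (there p) = begin
    f y ∙ fold ys f                                 ≈⟨ ∙-congˡ (fold-─ f p) ⟩
    f y ∙ (f (Any.lookup p) ∙ fold (ys ─ p) f)      ≈⟨ sym (assoc _ _ _) ⟩
    (f y ∙ f (Any.lookup p)) ∙ fold (ys ─ p) f      ≈⟨ ∙-congʳ (comm _ _) ⟩
    (f (Any.lookup p) ∙ f y) ∙ fold (ys ─ p) f      ≈⟨ assoc _ _ _ ⟩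
    f (Any.lookup p) ∙ (f y ∙ fold (ys ─ p) f)      ∎

  ─-distinct : ∀ {x ys} (p : x ∈ ys) → Distinct ys → Distinct (ys ─ p)
  ─-distinct (here _) (_ ∷ d) = d
  ─-distinct (there p) (y≄ys ∷ d) = All.─⁺ p y≄ys ∷ ─-distinct p d

  ∈-─ : ∀ {x z ys} (p : x ∈ ys) → z ∈ ys → ¬ z ≃ Any.lookup p → z ∈ (ys ─ p)
  ∈-─ (here _) (here z≃y) z≄y = ⊥-elim (z≄y z≃y)
  ∈-─ (here _) (there q) _ = q
  ∈-─ (there p) (here z≃y) _ = here z≃y
  ∈-─ (there p) (there q) z≄ = there (∈-─ p q z≄)

  ─-excludes : ∀ {x ys} (p : x ∈ ys) → Distinct ys → All (λ z → ¬ z ≃ Any.lookup p) (ys ─ p)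
  ─-excludes (here _) (y≄ys ∷ _) = All.map (λ y≄z z≃y → y≄z (S.sym z≃y)) y≄ys
  ─-excludes (there p) (y≄ys ∷ d) = proj₁ (All.lookupAny y≄ys p) ∷ ─-excludes p d

  module _ (f : A → Carrier) (f-cong : ∀ {x y} → x ≃ y → f x ≈ f y) where

    fold-⊆ : ∀ xs ys → Distinct xs → Distinct ys → length xs ≡ length ys →
             All (_∈ ys) xs → fold xs f ≈ fold ys f
    fold-⊆ [] [] _ _ _ _ = refl
    fold-⊆ (x ∷ xs) ys (x≄xs ∷ dxs) dys |xs|≡|ys| (p ∷ xs⊆ys) = begin
      f x ∙ fold xs f
        ≈⟨ ∙-cong (f-cong (Any.lookup-result p)) (fold-⊆ xs (ys ─ p) dxs (─-distinct p dys) |xs|≡|ys─p| xs⊆ys─p) ⟩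
      f (Any.lookup p) ∙ fold (ys ─ p) f
        ≈⟨ sym (fold-─ f p) ⟩
      fold ys f
        ∎
      where
      |xs|≡|ys─p| : length xs ≡ length (ys ─ p)
      |xs|≡|ys─p| = ℕ.suc-injective (≡.trans |xs|≡|ys| (List.length-removeAt′ ys (Any.index p)))
      xs⊆ys─p : All (_∈ (ys ─ p)) xs
      xs⊆ys─p = All.zipWith (λ (x≄z , z∈ys) → ∈-─ p z∈ys (λ z≃ → x≄z (S.trans (Any.lookup-result p) (S.sym z≃))))
                            (x≄xs , xs⊆ys)

    fold-reindex : (h : A → A) → (∀ {x y} → h x ≃ h y → x ≃ y) →
                   ∀ ys → Distinct ys → All (λ y → h y ∈ ys) ys → fold ys (λ y → f (h y)) ≈ fold ys f
    fold-reindex h h-injective ys dys h[ys]⊆ys = begin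
      fold ys (λ y → f (h y)) ≡⟨ ≡.cong (foldr _∙_ ε) (List.map-∘ ys) ⟩
      fold (map h ys) f       ≈⟨ fold-⊆ (map h ys) ys h[ys]-distinct dys (List.length-map h ys) (All.map⁺ h[ys]⊆ys) ⟩
      fold ys f               ∎
      where
      h[ys]-distinct : Distinct (map h ys)
      h[ys]-distinct = AllPairs.map⁺ (AllPairs.map (λ x≄y hx≃hy → x≄y (h-injective hx≃hy)) dys)

module Enumeration {c ℓ} (F : CommutativeRing c ℓ) (elems : List (CommutativeRing.Carrier F))
                   (isEnumeration : IsEnumeration F elems) where
  open CommutativeRing F
  open Pointwise using (Pointwise; []; _∷_)

  q : ℕ
  q = length elems

  elems-complete : ∀ x → Any (x ≈_) elems
  elems-complete = proj₁ isEnumeration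

  elems-distinct : AllPairs (λ x y → ¬ x ≈ y) elems
  elems-distinct = proj₂ isEnumeration

  _≟_ : ∀ x y → Dec (x ≈ y)
  x ≟ y = decide elems-distinct (elems-complete x) (elems-complete y)
    where
    excluded : ∀ {a y es} → All (λ z → ¬ a ≈ z) es → Any (y ≈_) es → ¬ a ≈ y
    excluded a≄es y∈es a≈y = proj₁ (All.lookupAny a≄es y∈es) (trans a≈y (Any.lookup-result y∈es))
    decide : ∀ {x y es} → AllPairs (λ x y → ¬ x ≈ y) es → Any (x ≈_) es → Any (y ≈_) es → Dec (x ≈ y)
    decide _ (here x≈e) (here y≈e) = yes (trans x≈e (sym y≈e))
    decide (e≄es ∷ _) (here x≈e) (there y∈es) = no (λ x≈y → excluded e≄es y∈es (trans (sym x≈e) x≈y))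
    decide (e≄es ∷ _) (there x∈es) (here y≈e) = no (λ x≈y → excluded e≄es x∈es (trans (sym y≈e) (sym x≈y)))
    decide (_ ∷ d) (there x∈es) (there y∈es) = decide d x∈es y∈es

  infix 4 _≈ᵛ_
  _≈ᵛ_ : ∀ {n} → Vec Carrier n → Vec Carrier n → Set _
  _≈ᵛ_ = Pointwise _≈_

  vecSetoid : ℕ → Setoid _ _
  vecSetoid = Pointwise.setoid setoid

  _≟ᵛ_ : ∀ {n} (u v : Vec Carrier n) → Dec (u ≈ᵛ v)
  _≟ᵛ_ = Pointwise.decidable _≟_

  private
    prefixes : ∀ n → List Carrier → List (Vec Carrier (suc n))
    prefixes n = concatMap (λ x → map (x ∷_) (allPolys F elems n))

  allPolys-complete : ∀ n (v : Vec Carrier n) → Any (v ≈ᵛ_) (allPolys F elems n)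
  allPolys-complete zero [] = here []
  allPolys-complete (suc n) (x ∷ v) = ∈-prefixes elems (elems-complete x)
    where
    ∈-prefixes : ∀ es → Any (x ≈_) es → Any ((x ∷ v) ≈ᵛ_) (prefixes n es)
    ∈-prefixes (e ∷ es) (here x≈e) = Any.++⁺ˡ (Any.map⁺ (Any.map (x≈e ∷_) (allPolys-complete n v)))
    ∈-prefixes (e ∷ es) (there x∈es) = Any.++⁺ʳ (map (e ∷_) (allPolys F elems n)) (∈-prefixes es x∈es)

  allPolys-distinct : ∀ n → AllPairs (λ u v → ¬ u ≈ᵛ v) (allPolys F elems n)
  allPolys-distinct zero = [] ∷ []
  allPolys-distinct (suc n) = prefixes-distinct elems elems-distinct
    where
    heads≄ : ∀ {x} es → All (λ e → ¬ x ≈ e) es → All (λ v → ¬ x ≈ Vec.head v) (prefixes n es)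
    heads≄ [] [] = []
    heads≄ (e ∷ es) (x≄e ∷ x≄es) = All.++⁺ (All.map⁺ (All.universal (λ _ → x≄e) _)) (heads≄ es x≄es)
    cons≄ : ∀ {x} u {v : Vec Carrier (suc n)} → ¬ x ≈ Vec.head v → ¬ (x ∷ u) ≈ᵛ v
    cons≄ u x≄ (x≈ ∷ _) = x≄ x≈
    prefixes-distinct : ∀ es → AllPairs (λ x y → ¬ x ≈ y) es → AllPairs (λ u v → ¬ u ≈ᵛ v) (prefixes n es)
    prefixes-distinct [] [] = []
    prefixes-distinct (e ∷ es) (e≄es ∷ d) = AllPairs.++⁺
      (AllPairs.map⁺ (AllPairs.map (λ u≄v eu≈ev → u≄v (Pointwise.tail eu≈ev)) (allPolys-distinct n)))
      (prefixes-distinct es d)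
      (All.map⁺ (All.universal (λ u → All.map (cons≄ u) (heads≄ es e≄es)) _))

  length-allPolys : ∀ n → length (allPolys F elems n) ≡ q ℕ.^ n
  length-allPolys zero = ≡.refl
  length-allPolys (suc n) = ≡.trans (length-prefixes elems) (≡.cong (q ℕ.*_) (length-allPolys n))
    where
    length-prefixes : ∀ es → length (prefixes n es) ≡ length es ℕ.* length (allPolys F elems n)
    length-prefixes [] = ≡.refl
    length-prefixes (e ∷ es) = ≡.trans (List.length-++ (map (e ∷_) (allPolys F elems n)))
                                       (≡.cong₂ ℕ._+_ (List.length-map (e ∷_) (allPolys F elems n)) (length-prefixes es))

[j+k]%Q≡k∸[Q∸j] : ∀ Q {j k} → j < Q → Q ∸ j ≤ k → k < Q → (j ℕ.+ k) % suc (Q ∸ 1) ≡ k ∸ (Q ∸ j)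
[j+k]%Q≡k∸[Q∸j] Q@(suc Q-1) {j} {k} j<Q Q-j≤k k<Q = begin
  (j ℕ.+ k) % Q                      ≡⟨ ≡.cong (_% Q) j+k≡k-[Q-j]+Q ⟩
  (k ∸ (Q ∸ j) ℕ.+ Q) % Q            ≡⟨ [m+n]%n≡m%n (k ∸ (Q ∸ j)) Q ⟩
  (k ∸ (Q ∸ j)) % Q                  ≡⟨ m≤n⇒m%n≡m (ℕ.≤-pred (ℕ.≤-<-trans (ℕ.m∸n≤m k (Q ∸ j)) k<Q)) ⟩
  k ∸ (Q ∸ j)                        ∎
  where
  open ≡.≡-Reasoning
  j+k≡k-[Q-j]+Q : j ℕ.+ k ≡ k ∸ (Q ∸ j) ℕ.+ Q
  j+k≡k-[Q-j]+Q = begin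
    j ℕ.+ k                            ≡⟨ ≡.cong (j ℕ.+_) (≡.sym (ℕ.m+[n∸m]≡n Q-j≤k)) ⟩
    j ℕ.+ ((Q ∸ j) ℕ.+ (k ∸ (Q ∸ j)))  ≡⟨ ≡.sym (ℕ.+-assoc j (Q ∸ j) _) ⟩
    j ℕ.+ (Q ∸ j) ℕ.+ (k ∸ (Q ∸ j))    ≡⟨ ≡.cong (ℕ._+ (k ∸ (Q ∸ j))) (ℕ.m+[n∸m]≡n (ℕ.<⇒≤ j<Q)) ⟩
    Q ℕ.+ (k ∸ (Q ∸ j))                ≡⟨ ℕ.+-comm Q _ ⟩
    k ∸ (Q ∸ j) ℕ.+ Q                  ∎

module CoefficientArithmetic {c ℓ} (F : CommutativeRing c ℓ) where
  open CommutativeRing F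
  open CommutativeRingSolver F
  open ListPointwise using ([]; _∷_)
  private module ≋ = Setoid (ListPointwise.setoid setoid)

  infix 4 _≋_
  _≋_ : List Carrier → List Carrier → Set _
  _≋_ = _≈P_ F

  infixl 6 _⊕_
  _⊕_ : List Carrier → List Carrier → List Carrier
  _⊕_ = addP F

  infixl 7 _⊛_
  _⊛_ : List Carrier → List Carrier → List Carrier
  _⊛_ = mulP F

  ⊕-cong : ∀ {u u′ v v′} → u ≋ u′ → v ≋ v′ → u ⊕ v ≋ u′ ⊕ v′
  ⊕-cong [] v≋v′ = v≋v′
  ⊕-cong (x≈ ∷ u≋) [] = x≈ ∷ u≋
  ⊕-cong (x≈ ∷ u≋) (y≈ ∷ v≋) = +-cong x≈ y≈ ∷ ⊕-cong u≋ v≋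

  ⊕-assoc : ∀ u v w → (u ⊕ v) ⊕ w ≋ u ⊕ (v ⊕ w)
  ⊕-assoc [] v w = ≋.refl
  ⊕-assoc (x ∷ u) [] w = ≋.refl
  ⊕-assoc (x ∷ u) (y ∷ v) [] = ≋.refl
  ⊕-assoc (x ∷ u) (y ∷ v) (z ∷ w) = +-assoc x y z ∷ ⊕-assoc u v w

  ⊕-comm : ∀ u v → u ⊕ v ≋ v ⊕ u
  ⊕-comm [] [] = []
  ⊕-comm [] (y ∷ v) = ≋.refl
  ⊕-comm (x ∷ u) [] = ≋.refl
  ⊕-comm (x ∷ u) (y ∷ v) = +-comm x y ∷ ⊕-comm u v

  ⊕-identityʳ : ∀ u → u ⊕ [] ≋ u
  ⊕-identityʳ [] = []
  ⊕-identityʳ (x ∷ u) = ≋.refl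

  ⊕-commutativeMonoid : CommutativeMonoid _ _
  ⊕-commutativeMonoid = record
    { isCommutativeMonoid = record
      { isMonoid = record
        { isSemigroup = record
          { isMagma = record { isEquivalence = ≋.isEquivalence ; ∙-cong = ⊕-cong }
          ; assoc = ⊕-assoc }
        ; identity = (λ _ → ≋.refl) , ⊕-identityʳ }
      ; comm = ⊕-comm } }

  length-⊕ : ∀ u v → length (u ⊕ v) ≡ length u ⊔ length v
  length-⊕ [] v = ≡.refl
  length-⊕ (x ∷ u) [] = ≡.refl
  length-⊕ (x ∷ u) (y ∷ v) = ≡.cong suc (length-⊕ u v)

  length-⊛ : ∀ t g → 1 ≤ length t → length g ≤ length (t ⊛ g)
  length-⊛ (x ∷ t) g _ = ≡.subst (length g ≤_) (≡.sym (length-⊕ (map (x *_) g) _))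
    (≡.subst (λ n → length g ≤ n ⊔ suc (length (t ⊛ g))) (≡.sym (List.length-map (x *_) g)) (ℕ.m≤m⊔n _ _))

  ⊕-zerosʳ : ∀ u s → All (_≈ 0#) s → length s ≤ length u → u ⊕ s ≋ u
  ⊕-zerosʳ u [] _ _ = ⊕-identityʳ u
  ⊕-zerosʳ (x ∷ u) (y ∷ s) (y≈0 ∷ s≈0) (s≤s |s|≤|u|) = trans (+-congˡ y≈0) (+-identityʳ x) ∷ ⊕-zerosʳ u s s≈0 |s|≤|u|

  1⊛g≋g : ∀ g → 1 ≤ length g → [ 1# ] ⊛ g ≋ g
  1⊛g≋g (x ∷ g) _ = trans (+-identityʳ _) (*-identityˡ x) ∷ ≋.trans (⊕-identityʳ _) (1*g≋g g)
    where
    1*g≋g : ∀ g → map (1# *_) g ≋ g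
    1*g≋g [] = []
    1*g≋g (y ∷ g) = *-identityˡ y ∷ 1*g≋g g

  0ᵛ : ∀ {n} → Vec Carrier n
  0ᵛ = Vec.replicate _ 0#

  infixl 6 _+ᵛ_ _-ᵛ_
  _+ᵛ_ _-ᵛ_ : ∀ {n} → Vec Carrier n → Vec Carrier n → Vec Carrier n
  _+ᵛ_ = Vec.zipWith _+_
  _-ᵛ_ = subV F

  infixl 7 _*ᵛ_
  _*ᵛ_ : ∀ {n} → Carrier → Vec Carrier n → Vec Carrier n
  a *ᵛ v = Vec.map (a *_) v

  private
    monic-⊕-difference : ∀ gs ps → length ps ≡ length gs → monic F gs ⊕ zipWith _-_ ps gs ≋ monic F ps
    monic-⊕-difference [] [] _ = ≋.refl
    monic-⊕-difference (g ∷ gs) (p ∷ ps) |ps|≡|gs| =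
      solve 2 (λ g p → g :+ (p :- g) := p) refl g p ∷ monic-⊕-difference gs ps (ℕ.suc-injective |ps|≡|gs|)

    scaled-cancel : ∀ a x w e → length x ≡ length w →
                    (map (a *_) w ++ [ e ]) ⊕ (x ⊕ map (λ y → - (a * y)) w) ≋ x ++ [ e ]
    scaled-cancel a [] [] e _ = refl ∷ []
    scaled-cancel a (x ∷ xs) (y ∷ ys) e |xs|≡|ys| =
      solve 3 (λ a y x → a :* y :+ (x :+ (:- (a :* y))) := x) refl a y x ∷ scaled-cancel a xs ys e (ℕ.suc-injective |xs|≡|ys|)

  -- Synthetic division from the constant term up: for the dividend p + θ P with P = T G + S and
  -- S = R + c θᵐ, the relation θᵐ = G − gs gives p + θ P = (c + θ T) G + (p + θ R − c gs).
  monic-division : ∀ gs → 1 ≤ length gs → ∀ k ps → length ps ≡ k ℕ.+ length gs →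
    ∃₂ λ ts s → length ts ≡ k × length s ≡ length gs × monic F ps ≋ monic F ts ⊛ monic F gs ⊕ s
  monic-division gs 1≤|gs| zero ps |ps|≡|gs| =
    [] , zipWith _-_ ps gs , ≡.refl , |ps-gs| , ≋.sym division
    where
    |ps-gs| : length (zipWith _-_ ps gs) ≡ length gs
    |ps-gs| = ≡.trans (List.length-zipWith _-_ ps gs) (≡.trans (≡.cong (ℕ._⊓ length gs) |ps|≡|gs|) (ℕ.⊓-idem _))
    division : [ 1# ] ⊛ monic F gs ⊕ zipWith _-_ ps gs ≋ monic F ps
    division = ≋.trans (⊕-cong (1⊛g≋g (monic F gs) (≡.subst (1 ≤_) (≡.sym (List.length-++ gs)) (ℕ.m≤n+m 1 _))) ≋.refl)
                       (monic-⊕-difference gs ps |ps|≡|gs|)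
  monic-division gs 1≤|gs| (suc k) (p ∷ ps) |p∷ps|≡ with monic-division gs 1≤|gs| k ps (ℕ.suc-injective |p∷ps|≡)
  ... | ts , s , |ts|≡k , |s|≡|gs| , division with initLast s
  ...   | [] = ⊥-elim (ℕ.<⇒≢ 1≤|gs| |s|≡|gs|)
  ...   | r ∷ʳ′ c = c ∷ ts , s′ , ≡.cong suc |ts|≡k , |s′|≡|gs| , ≋.sym division′
    where
    negated s′ G T : List Carrier
    negated = map (λ y → - (c * y)) gs
    s′ = [ p ] ⊕ ((0# ∷ r) ⊕ negated)
    G = monic F gs
    T = monic F ts
    |0∷r|≡|gs| : length (0# ∷ r) ≡ length gs
    |0∷r|≡|gs| = ≡.trans (ℕ.+-comm 1 (length r)) (≡.trans (≡.sym (List.length-++ r)) |s|≡|gs|)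
    |s′|≡|gs| : length s′ ≡ length gs
    |s′|≡|gs| = begin
      length s′                                ≡⟨ length-⊕ [ p ] ((0# ∷ r) ⊕ negated) ⟩
      1 ⊔ length ((0# ∷ r) ⊕ negated)          ≡⟨ ≡.cong (1 ⊔_) (length-⊕ (0# ∷ r) negated) ⟩
      1 ⊔ (length (0# ∷ r) ⊔ length negated)   ≡⟨ ≡.cong₂ (λ a b → 1 ⊔ (a ⊔ b)) |0∷r|≡|gs| (List.length-map (λ y → - (c * y)) gs) ⟩
      1 ⊔ (length gs ⊔ length gs)              ≡⟨ ≡.cong (1 ⊔_) (ℕ.⊔-idem (length gs)) ⟩
      1 ⊔ length gs                            ≡⟨ ℕ.m≤n⇒m⊔n≡n 1≤|gs| ⟩
      length gs                                ∎
      where open ≡.≡-Reasoning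
    shifted : map (c *_) G ⊕ ((0# ∷ r) ⊕ negated) ≋ 0# ∷ s
    shifted = ≋.trans (≋.reflexive (≡.cong (_⊕ ((0# ∷ r) ⊕ negated)) (List.map-++ (c *_) gs [ 1# ])))
                      (≋.trans (scaled-cancel c (0# ∷ r) gs (c * 1#) |0∷r|≡|gs|)
                               (ListPointwise.++⁺ (≋.refl {0# ∷ r}) (*-identityʳ c ∷ [])))
    division′ : (map (c *_) G ⊕ (0# ∷ T ⊛ G)) ⊕ s′ ≋ p ∷ monic F ps
    division′ = begin
      (map (c *_) G ⊕ (0# ∷ T ⊛ G)) ⊕ ([ p ] ⊕ ((0# ∷ r) ⊕ negated)) ≈⟨ rearrange (map (c *_) G) (0# ∷ T ⊛ G) [ p ] ((0# ∷ r) ⊕ negated) ⟩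
      [ p ] ⊕ ((0# ∷ T ⊛ G) ⊕ (map (c *_) G ⊕ ((0# ∷ r) ⊕ negated))) ≈⟨ ⊕-cong (≋.refl {[ p ]}) (⊕-cong (≋.refl {0# ∷ T ⊛ G}) shifted) ⟩
      (p + (0# + 0#)) ∷ (T ⊛ G ⊕ s)                                   ≈⟨ trans (+-congˡ (+-identityʳ 0#)) (+-identityʳ p) ∷ ≋.sym division ⟩
      p ∷ monic F ps                                                  ∎
      where
      open import Relation.Binary.Reasoning.Setoid (ListPointwise.setoid setoid)
      open import Algebra.Solver.CommutativeMonoid ⊕-commutativeMonoid using (prove; var) renaming (_⊕_ to _∙_)
      rearrange : ∀ A B C D → (A ⊕ B) ⊕ (C ⊕ D) ≋ C ⊕ (B ⊕ (A ⊕ D))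
      rearrange A B C D =
        prove 4 ((var 0F ∙ var 1F) ∙ (var 2F ∙ var 3F)) (var 2F ∙ (var 1F ∙ (var 0F ∙ var 3F))) (A ∷ B ∷ C ∷ D ∷ [])

module Evaluation {c ℓ c′ ℓ′} (F : CommutativeRing c ℓ) (K : CommutativeRing c′ ℓ′)
    (φ : CommutativeRing.Carrier F → CommutativeRing.Carrier K)
    (φ-isHomomorphism : RingMorphisms.IsRingHomomorphism (CommutativeRing.rawRing F) (CommutativeRing.rawRing K) φ)
    where
  private
    module F = CommutativeRing F
    module φ = RingMorphisms.IsRingHomomorphism φ-isHomomorphism
  open CommutativeRing K
  open CommutativeRingSolver K
  open Eval F K φ
  open CoefficientArithmetic F using (_≋_; _⊕_; _⊛_; 0ᵛ; _+ᵛ_; _-ᵛ_; _*ᵛ_)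
  open ListPointwise using ([]; _∷_)
  open Pointwise using (Pointwise; []; _∷_)
  open import Algebra.Properties.Ring ring using (-0#≈0#)
  open import Algebra.Properties.CommutativeSemiring.Exp commutativeSemiring using (_^_; ^-congˡ)
  open import Algebra.Properties.Semiring.Mult semiring using () renaming (_×_ to _·_)
  open import Relation.Binary.Reasoning.Setoid setoid

  pow≡^ : ∀ x n → pow x n ≡ x ^ n
  pow≡^ x zero = ≡.refl
  pow≡^ x (suc n) = ≡.cong (x *_) (pow≡^ x n)

  pow-congˡ : ∀ n {x y} → x ≈ y → pow x n ≈ pow y n
  pow-congˡ n {x} {y} x≈y = trans (reflexive (pow≡^ x n)) (trans (^-congˡ n x≈y) (reflexive (≡.sym (pow≡^ y n))))

  natK≡·1 : ∀ n → natK n ≡ n · 1#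
  natK≡·1 zero = ≡.refl
  natK≡·1 (suc n) = ≡.cong (1# +_) (natK≡·1 n)

  prodFin-cong : ∀ r {f g : Fin r → Carrier} → (∀ i → f i ≈ g i) → prodFin r f ≈ prodFin r g
  prodFin-cong zero f≈g = refl
  prodFin-cong (suc r) f≈g = *-cong (f≈g fzero) (prodFin-cong r (λ i → f≈g (fsuc i)))

  prodFin-distrib-* : ∀ r (f g : Fin r → Carrier) → prodFin r (λ i → f i * g i) ≈ prodFin r f * prodFin r g
  prodFin-distrib-* zero f g = sym (*-identityˡ 1#)
  prodFin-distrib-* (suc r) f g = trans (*-congˡ (prodFin-distrib-* r (λ i → f (fsuc i)) (λ i → g (fsuc i))))
    (solve 4 (λ a b c d → (a :* b) :* (c :* d) := (a :* c) :* (b :* d)) refl _ _ _ _)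

  evalL-cong : ∀ {u v} z → u ≋ v → evalL u z ≈ evalL v z
  evalL-cong z [] = refl
  evalL-cong z (x≈y ∷ u≋v) = +-cong (φ.⟦⟧-cong x≈y) (*-congˡ (evalL-cong z u≋v))

  evalL-++ : ∀ u v z → evalL (u ++ v) z ≈ evalL u z + z ^ length u * evalL v z
  evalL-++ [] v z = sym (trans (+-identityˡ _) (*-identityˡ _))
  evalL-++ (a ∷ u) v z = trans (+-congˡ (*-congˡ (evalL-++ u v z)))
    (solve 5 (λ a z x p y → a :+ z :* (x :+ p :* y) := (a :+ z :* x) :+ z :* p :* y) refl _ _ _ _ _)

  evalL-map-* : ∀ a v z → evalL (map (a F.*_) v) z ≈ φ a * evalL v z
  evalL-map-* a [] z = sym (zeroʳ _)
  evalL-map-* a (b ∷ v) z = trans (+-cong (φ.*-homo a b) (*-congˡ (evalL-map-* a v z)))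
    (solve 4 (λ a b z x → a :* b :+ z :* (a :* x) := a :* (b :+ z :* x)) refl _ _ _ _)

  evalL-⊕ : ∀ u v z → evalL (u ⊕ v) z ≈ evalL u z + evalL v z
  evalL-⊕ [] v z = sym (+-identityˡ _)
  evalL-⊕ (a ∷ u) [] z = sym (+-identityʳ _)
  evalL-⊕ (a ∷ u) (b ∷ v) z = trans (+-cong (φ.+-homo a b) (*-congˡ (evalL-⊕ u v z)))
    (solve 5 (λ a b z x y → a :+ b :+ z :* (x :+ y) := (a :+ z :* x) :+ (b :+ z :* y)) refl _ _ _ _ _)

  evalL-⊛ : ∀ u v z → evalL (u ⊛ v) z ≈ evalL u z * evalL v z
  evalL-⊛ [] v z = sym (zeroˡ _)
  evalL-⊛ (a ∷ u) v z = begin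
    evalL (map (a F.*_) v ⊕ (F.0# ∷ u ⊛ v)) z
      ≈⟨ evalL-⊕ (map (a F.*_) v) _ z ⟩
    evalL (map (a F.*_) v) z + (φ F.0# + z * evalL (u ⊛ v) z)
      ≈⟨ +-cong (evalL-map-* a v z) (trans (+-cong φ.0#-homo (*-congˡ (evalL-⊛ u v z))) (+-identityˡ _)) ⟩
    φ a * evalL v z + z * (evalL u z * evalL v z)
      ≈⟨ solve 4 (λ a y z x → a :* y :+ z :* (x :* y) := (a :+ z :* x) :* y) refl _ _ _ _ ⟩
    (φ a + z * evalL u z) * evalL v z
      ∎

  evalL-monic : ∀ cs z → evalL (monic F cs) z ≈ z ^ length cs + evalL cs z
  evalL-monic cs z = begin
    evalL (cs ++ [ F.1# ]) z
      ≈⟨ evalL-++ cs [ F.1# ] z ⟩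
    evalL cs z + z ^ length cs * (φ F.1# + z * 0#)
      ≈⟨ +-congˡ (trans (*-congˡ (trans (+-cong φ.1#-homo (zeroʳ z)) (+-identityʳ 1#))) (*-identityʳ _)) ⟩
    evalL cs z + z ^ length cs
      ≈⟨ +-comm _ _ ⟩
    z ^ length cs + evalL cs z
      ∎

  monic-root : ∀ cs z → pow z (length cs) + evalL cs z ≈ 0# → evalL (monic F cs) z ≈ 0#
  monic-root cs z root = trans (evalL-monic cs z) (trans (+-congʳ (reflexive (≡.sym (pow≡^ z (length cs))))) root)

  evalL-zeros : ∀ l z → All (F._≈ F.0#) l → evalL l z ≈ 0#
  evalL-zeros [] z [] = refl
  evalL-zeros (a ∷ l) z (a≈0 ∷ l≈0) =
    trans (+-cong (trans (φ.⟦⟧-cong a≈0) φ.0#-homo) (trans (*-congˡ (evalL-zeros l z l≈0)) (zeroʳ z))) (+-identityˡ 0#)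

  evalV-0ᵛ : ∀ {n} z → evalV (0ᵛ {n}) z ≈ 0#
  evalV-0ᵛ {zero} z = refl
  evalV-0ᵛ {suc n} z = trans (+-cong φ.0#-homo (trans (*-congˡ (evalV-0ᵛ {n} z)) (zeroʳ z))) (+-identityˡ 0#)

  evalV-+ᵛ : ∀ {n} (u v : Vec F.Carrier n) z → evalV (u +ᵛ v) z ≈ evalV u z + evalV v z
  evalV-+ᵛ [] [] z = sym (+-identityˡ 0#)
  evalV-+ᵛ (a ∷ u) (b ∷ v) z = trans (+-cong (φ.+-homo a b) (*-congˡ (evalV-+ᵛ u v z)))
    (solve 5 (λ a b z x y → a :+ b :+ z :* (x :+ y) := (a :+ z :* x) :+ (b :+ z :* y)) refl _ _ _ _ _)

  evalV-subV : ∀ {n} (u v : Vec F.Carrier n) z → evalV (u -ᵛ v) z ≈ evalV u z - evalV v z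
  evalV-subV [] [] z = sym (trans (+-congˡ -0#≈0#) (+-identityˡ 0#))
  evalV-subV (a ∷ u) (b ∷ v) z = trans (+-cong (trans (φ.+-homo a (F.- b)) (+-congˡ (φ.-‿homo b))) (*-congˡ (evalV-subV u v z)))
    (solve 5 (λ a b z x y → a :- b :+ z :* (x :- y) := (a :+ z :* x) :- (b :+ z :* y)) refl _ _ _ _ _)

  evalV-*ᵛ : ∀ {n} a (v : Vec F.Carrier n) z → evalV (a *ᵛ v) z ≈ φ a * evalV v z
  evalV-*ᵛ a [] z = sym (zeroʳ _)
  evalV-*ᵛ a (b ∷ v) z = trans (+-cong (φ.*-homo a b) (*-congˡ (evalV-*ᵛ a v z)))
    (solve 4 (λ a b z x → a :* b :+ z :* (a :* x) := a :* (b :+ z :* x)) refl _ _ _ _)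

  evalV-cong : ∀ {n} {u v : Vec F.Carrier n} z → Pointwise F._≈_ u v → evalV u z ≈ evalV v z
  evalV-cong z [] = refl
  evalV-cong z (a≈b ∷ u≈v) = +-cong (φ.⟦⟧-cong a≈b) (*-congˡ (evalV-cong z u≈v))

  evalV-∷ʳ : ∀ {n} (v : Vec F.Carrier n) a z → evalV (v Vec.∷ʳ a) z ≈ evalV v z + z ^ n * φ a
  evalV-∷ʳ [] a z = trans (+-congˡ (zeroʳ z)) (trans (+-identityʳ _) (sym (trans (+-identityˡ _) (*-identityˡ _))))
  evalV-∷ʳ (b ∷ v) a z = trans (+-congˡ (*-congˡ (evalV-∷ʳ v a z)))
    (solve 5 (λ b z x p a → b :+ z :* (x :+ p :* a) := (b :+ z :* x) :+ z :* p :* a) refl _ _ _ _ _)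

  evalV-fromList : ∀ cs z → evalV (Vec.fromList cs) z ≈ evalL cs z
  evalV-fromList [] z = refl
  evalV-fromList (a ∷ cs) z = +-congˡ (*-congˡ (evalV-fromList cs z))

  evalL-toList : ∀ {n} (v : Vec F.Carrier n) z → evalL (Vec.toList v) z ≈ evalV v z
  evalL-toList [] z = refl
  evalL-toList (a ∷ v) z = +-congˡ (*-congˡ (evalL-toList v z))

module FiniteFieldSums {c ℓ c′ ℓ′}
    (F : CommutativeRing c ℓ) (F-isField : IsField F)
    (elems : List (CommutativeRing.Carrier F)) (elems-enumeration : IsEnumeration F elems)
    (K : CommutativeRing c′ ℓ′) (K-isField : IsField K)
    (φ : CommutativeRing.Carrier F → CommutativeRing.Carrier K)
    (φ-isHomomorphism : RingMorphisms.IsRingHomomorphism (CommutativeRing.rawRing F) (CommutativeRing.rawRing K) φ)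
    where
  private
    module F where
      open CommutativeRing F public
      open FieldProperties F F-isField public
      open import Algebra.Properties.Ring ring public using (x∙y⁻¹≈ε⇒x≈y; +-cancelʳ)
    module φ = RingMorphisms.IsRingHomomorphism φ-isHomomorphism
  open CommutativeRing K hiding (zero)
  open CommutativeRingSolver K
  open FieldProperties K K-isField
  open Eval F K φ
  open Evaluation F K φ φ-isHomomorphism
  open CoefficientArithmetic F
  open Enumeration F elems elems-enumeration
  open ListSum K
  open MinusOnePowers K using (-1^m*-1≈-1^[j∸1])
  open import Algebra.Definitions _≈_ using (Congruent₁)
  open import Algebra.Properties.CommutativeSemiring.Exp commutativeSemiring using (_^_; ^-homo-*; ^-distrib-*; ^-congˡ)
  open import Algebra.Properties.Semiring.Mult semiring using (×1-homo-*; ×-assoc-*; ×-congʳ) renaming (_×_ to _·_)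
  open import Algebra.Properties.Semiring.Sum semiring using (sum; sum-cong-≋; *-distribˡ-sum)
  open import Algebra.Properties.CommutativeSemiring.Binomial commutativeSemiring
    using (binomialTerm) renaming (theorem to binomial-theorem)
  open import Algebra.Properties.Ring ring using (+-cancelˡ; +-inverseʳ-unique; -‿involutive; -0#≈0#; -1*x≈-x)
  open import Relation.Binary.Reasoning.Setoid setoid

  IsZero : F.Carrier → Set _
  IsZero = F._≈ F.0#

  split-last-nonzero : ∀ l → ¬ All IsZero l →
                       ∃₂ λ l₁ a → ∃ λ zs → l ≡ l₁ ++ a ∷ zs × ¬ IsZero a × All IsZero zs
  split-last-nonzero [] l≉0 = ⊥-elim (l≉0 [])
  split-last-nonzero (x ∷ l) x∷l≉0 with All.all? (_≟ F.0#) l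
  ... | yes l≈0 = [] , x , l , ≡.refl , (λ x≈0 → x∷l≉0 (x≈0 ∷ l≈0)) , l≈0
  ... | no l≉0 with split-last-nonzero l l≉0
  ...   | l₁ , a , zs , l≡ , a≉0 , zs≈0 = x ∷ l₁ , a , zs , ≡.cong (x ∷_) l≡ , a≉0 , zs≈0

  module RootOfIrreducible (cs : List F.Carrier) (cs-irreducible : MonicIrreducible F cs)
                           (ζ : Carrier) (ζ-root : evalL (monic F cs) ζ ≈ 0#) where

    d : ℕ
    d = length cs

    RemaindersVanish : ℕ → Set _
    RemaindersVanish m = ∀ s → length s ≡ m → evalL s ζ ≈ 0# → All IsZero s

    monic-factor : ∀ gs ps → 1 ≤ length gs → length gs ≤ length ps →
                   evalL (monic F gs) ζ ≈ 0# → evalL (monic F ps) ζ ≈ 0# → RemaindersVanish (length gs) →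
                   ∃ λ ts → length ts ≡ length ps ∸ length gs × monic F ps ≋ monic F ts ⊛ monic F gs
    monic-factor gs ps 1≤|gs| |gs|≤|ps| G[ζ]≈0 P[ζ]≈0 remainders-vanish
      with monic-division gs 1≤|gs| (length ps ∸ length gs) ps (≡.sym (ℕ.m∸n+n≡m |gs|≤|ps|))
    ... | ts , s , |ts|≡ , |s|≡|gs| , P≋TG⊕s = ts , |ts|≡ , ≋-trans P≋TG⊕s (⊕-zerosʳ (T ⊛ G) s s≈0 |s|≤|TG|)
      where
      open Setoid (ListPointwise.setoid F.setoid) using () renaming (trans to ≋-trans)
      T G : List F.Carrier
      T = monic F ts
      G = monic F gs
      s[ζ]≈0 : evalL s ζ ≈ 0#
      s[ζ]≈0 = begin
        evalL s ζ                         ≈⟨ sym (+-identityˡ _) ⟩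
        0# + evalL s ζ                    ≈⟨ +-congʳ (sym (trans (*-congˡ G[ζ]≈0) (zeroʳ _))) ⟩
        evalL T ζ * evalL G ζ + evalL s ζ ≈⟨ sym (trans (evalL-⊕ (T ⊛ G) s ζ) (+-congʳ (evalL-⊛ T G ζ))) ⟩
        evalL (T ⊛ G ⊕ s) ζ               ≈⟨ sym (evalL-cong ζ P≋TG⊕s) ⟩
        evalL (monic F ps) ζ              ≈⟨ P[ζ]≈0 ⟩
        0#                                ∎
      s≈0 : All IsZero s
      s≈0 = remainders-vanish s |s|≡|gs| s[ζ]≈0
      |s|≤|TG| : length s ≤ length (T ⊛ G)
      |s|≤|TG| = ℕ.≤-trans (ℕ.≤-trans (ℕ.≤-reflexive |s|≡|gs|) (ℕ.≤-trans (ℕ.m≤m+n _ 1) (ℕ.≤-reflexive (≡.sym (List.length-++ gs)))))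
                           (length-⊛ T G (≡.subst (1 ≤_) (≡.sym (List.length-++ ts)) (ℕ.m≤n+m 1 _)))

    private
      open Setoid (ListPointwise.setoid F.setoid) using () renaming (sym to ≋-sym; trans to ≋-trans)

      1≤d : 1 ≤ d
      1≤d = proj₁ cs-irreducible

      1≤|monic| : ∀ gs → 1 ≤ length (monic F gs)
      1≤|monic| gs = ≡.subst (1 ≤_) (≡.sym (List.length-++ gs)) (ℕ.m≤n+m 1 _)

      no-root-of-lower-degree : ∀ gs → length gs < d → evalL (monic F gs) ζ ≈ 0# → RemaindersVanish (length gs) → ⊥
      no-root-of-lower-degree [] _ 1[ζ]≈0 _ = 1≉0 (trans (sym (trans (+-cong φ.1#-homo (zeroʳ ζ)) (+-identityʳ 1#))) 1[ζ]≈0)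
      no-root-of-lower-degree gs@(_ ∷ _) |gs|<d G[ζ]≈0 remainders-vanish
        with monic-factor gs cs (s≤s z≤n) (ℕ.<⇒≤ |gs|<d) G[ζ]≈0 ζ-root remainders-vanish
      ... | ts , |ts|≡ , cs≋TG =
        proj₂ cs-irreducible (ts , gs , ≡.subst (1 ≤_) (≡.sym |ts|≡) (ℕ.m<n⇒0<n∸m |gs|<d) , s≤s z≤n , ≋-sym cs≋TG)

    -- A nonzero l of degree < d vanishing at ζ, scaled to be monic, would divide 𝔭: the remainder
    -- also vanishes at ζ and is zero by induction on the degree (n bounds the length of l).
    vanishing⇒zero : ∀ n → n ≤ d → ∀ l → length l ≤ n → evalL l ζ ≈ 0# → All IsZero l
    vanishing⇒zero zero _ [] _ _ = []
    vanishing⇒zero (suc n) n<d l |l|≤1+n l[ζ]≈0 with All.all? (_≟ F.0#) l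
    ... | yes l≈0 = l≈0
    ... | no l≉0 with split-last-nonzero l l≉0
    ...   | l₁ , a , zs , ≡.refl , a≉0 , zs≈0 with proj₂ F-isField a a≉0
    ...     | b , ab≈1 = ⊥-elim (no-root-of-lower-degree gs |gs|<d gs[ζ]≈0
                                   (λ s |s|≡|gs| → vanishing⇒zero n (ℕ.<⇒≤ n<d) s (ℕ.≤-trans (ℕ.≤-reflexive (≡.trans |s|≡|gs| |gs|≡m)) m≤n)))
      where
      m : ℕ
      m = length l₁
      gs : List F.Carrier
      gs = map (b F.*_) l₁
      |gs|≡m : length gs ≡ m
      |gs|≡m = List.length-map (b F.*_) l₁
      m<|l| : m < length (l₁ ++ a ∷ zs)
      m<|l| = ℕ.≤-trans (s≤s (ℕ.m≤m+n m (length zs))) (ℕ.≤-reflexive (≡.sym (≡.trans (List.length-++ l₁) (ℕ.+-suc m (length zs)))))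
      m≤n : m ≤ n
      m≤n = ℕ.≤-pred (ℕ.≤-trans m<|l| |l|≤1+n)
      |gs|<d : length gs < d
      |gs|<d = ≡.subst (_< d) (≡.sym |gs|≡m) (ℕ.≤-trans m<|l| (ℕ.≤-trans |l|≤1+n n<d))
      φaφb≈1 : φ a * φ b ≈ 1#
      φaφb≈1 = trans (sym (φ.*-homo a b)) (trans (φ.⟦⟧-cong ab≈1) φ.1#-homo)
      l[ζ] : evalL (l₁ ++ a ∷ zs) ζ ≈ evalL l₁ ζ + ζ ^ m * φ a
      l[ζ] = trans (evalL-++ l₁ (a ∷ zs) ζ)
                   (+-congˡ (*-congˡ (trans (+-congˡ (trans (*-congˡ (evalL-zeros zs ζ zs≈0)) (zeroʳ ζ))) (+-identityʳ _))))
      gs[ζ]≈0 : evalL (monic F gs) ζ ≈ 0#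
      gs[ζ]≈0 = begin
        evalL (monic F gs) ζ                   ≈⟨ evalL-monic gs ζ ⟩
        ζ ^ length gs + evalL gs ζ             ≈⟨ +-cong (reflexive (≡.cong (ζ ^_) |gs|≡m)) (evalL-map-* b l₁ ζ) ⟩
        ζ ^ m + φ b * evalL l₁ ζ               ≈⟨ +-congʳ (sym (trans (*-congˡ φaφb≈1) (*-identityʳ _))) ⟩
        ζ ^ m * (φ a * φ b) + φ b * evalL l₁ ζ ≈⟨ solve 4 (λ p a b x → p :* (a :* b) :+ b :* x := b :* (x :+ p :* a)) refl _ _ _ _ ⟩
        φ b * (evalL l₁ ζ + ζ ^ m * φ a)       ≈⟨ *-congˡ (trans (sym l[ζ]) l[ζ]≈0) ⟩
        φ b * 0#                               ≈⟨ zeroʳ _ ⟩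
        0#                                     ∎

    not-root-of-other-irreducible : ∀ cs′ → MonicIrreducible F cs′ → ¬ cs′ ≋ cs → ¬ evalL (monic F cs′) ζ ≈ 0#
    not-root-of-other-irreducible cs′ cs′-irreducible cs′≉cs P[ζ]≈0 with length cs′ ℕ.<? d
    ... | yes |cs′|<d = F.1≉0 (leading (All.++⁻ʳ cs′ (vanishing⇒zero d ℕ.≤-refl (monic F cs′) |P|≤d P[ζ]≈0)))
      where
      |P|≤d : length (monic F cs′) ≤ d
      |P|≤d = ≡.subst (_≤ d) (≡.sym (≡.trans (List.length-++ cs′) (ℕ.+-comm _ 1))) |cs′|<d
      leading : All IsZero [ F.1# ] → F.1# F.≈ F.0#
      leading (1≈0 ∷ []) = 1≈0
    ... | no |cs′|≮d with monic-factor cs cs′ 1≤d (ℕ.≮⇒≥ |cs′|≮d) ζ-root P[ζ]≈0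
                            (λ s |s|≡d → vanishing⇒zero d ℕ.≤-refl s (ℕ.≤-reflexive |s|≡d))
    ...   | [] , _ , cs′≋1·cs = cs′≉cs (ListPointwise.++-cancelʳ cs′ cs (≋-trans cs′≋1·cs (1⊛g≋g (monic F cs) (1≤|monic| cs))))
    ...   | t ∷ ts , _ , cs′≋TG = proj₂ cs′-irreducible (t ∷ ts , cs , s≤s z≤n , 1≤d , ≋-sym cs′≋TG)

  q·1≈0 : q · 1# ≈ 0#
  q·1≈0 = +-cancelˡ (Σ elems φ) (q · 1#) 0# (begin
    Σ elems φ + q · 1#                  ≈⟨ +-congˡ (sym (Σ-const elems 1#)) ⟩
    Σ elems φ + Σ elems (λ _ → 1#)      ≈⟨ sym (Σ-distrib-+ elems φ (λ _ → 1#)) ⟩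
    Σ elems (λ x → φ x + 1#)            ≈⟨ Σ-cong elems (λ x → sym (trans (φ.+-homo x F.1#) (+-congˡ φ.1#-homo))) ⟩
    Σ elems (λ x → φ (x F.+ F.1#))      ≈⟨ Reindexing.fold-reindex F.setoid +-commutativeMonoid φ φ.⟦⟧-cong (F._+ F.1#)
                                             (F.+-cancelʳ F.1# _ _) elems elems-distinct
                                             (All.universal (λ x → elems-complete (x F.+ F.1#)) elems) ⟩
    Σ elems φ                           ≈⟨ sym (+-identityʳ _) ⟩
    Σ elems φ + 0#                      ∎)

  module ResidueField (c₀ : F.Carrier) (cs′ : List F.Carrier)
                      (cs-irreducible : MonicIrreducible F (c₀ ∷ cs′))
                      (ζ : Carrier) (ζ-root : evalL (monic F (c₀ ∷ cs′)) ζ ≈ 0#) where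
    open RootOfIrreducible (c₀ ∷ cs′) cs-irreducible ζ ζ-root using (d; vanishing⇒zero)

    -- A residue modulo the prime is represented by its coefficient vector of length d; evaluation
    -- at ζ, injective on these, identifies the residues with the field F(ζ) ⊆ K.
    Residue : Set c
    Residue = Vec F.Carrier d

    ev : ∀ {n} → Vec F.Carrier n → Carrier
    ev v = evalV v ζ

    ev-cong : ∀ {u v : Residue} → u ≈ᵛ v → ev u ≈ ev v
    ev-cong = evalV-cong ζ

    ev-injective : ∀ {u v : Residue} → ev u ≈ ev v → u ≈ᵛ v
    ev-injective {u} {v} ev-u≈ev-v =
      coordinates u v (vanishing⇒zero d ℕ.≤-refl (Vec.toList (u -ᵛ v)) (ℕ.≤-reflexive (length-toList (u -ᵛ v))) u-v[ζ]≈0)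
      where
      coordinates : ∀ {n} (u v : Vec F.Carrier n) → All IsZero (Vec.toList (u -ᵛ v)) → u ≈ᵛ v
      coordinates [] [] [] = Pointwise.[]
      coordinates (a ∷ u) (b ∷ v) (a-b≈0 ∷ rest) = F.x∙y⁻¹≈ε⇒x≈y a b a-b≈0 Pointwise.∷ coordinates u v rest
      u-v[ζ]≈0 : evalL (Vec.toList (u -ᵛ v)) ζ ≈ 0#
      u-v[ζ]≈0 = trans (evalL-toList (u -ᵛ v) ζ) (trans (evalV-subV u v ζ) (trans (+-congʳ ev-u≈ev-v) (-‿inverseʳ _)))

    -- Multiplication by θ shifts the coefficients up; the overflowing θᵈ is replaced by its
    -- remainder −(c₀ ∷ cs′) modulo the prime.
    θ· : Residue → Residue
    θ· v = (F.0# ∷ Vec.init v) -ᵛ (Vec.last v *ᵛ Vec.fromList (c₀ ∷ cs′))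

    ev-θ· : ∀ v → ev (θ· v) ≈ ζ * ev v
    ev-θ· v = begin
      ev (θ· v)
        ≈⟨ evalV-subV (F.0# ∷ Vec.init v) (l *ᵛ csᵛ) ζ ⟩
      (φ F.0# + ζ * ev (Vec.init v)) - ev (l *ᵛ csᵛ)
        ≈⟨ +-cong (trans (+-congʳ φ.0#-homo) (+-identityˡ _)) (-‿cong (trans (evalV-*ᵛ l csᵛ ζ) (*-congˡ (evalV-fromList cs ζ)))) ⟩
      ζ * ev (Vec.init v) - φ l * evalL cs ζ
        ≈⟨ +-congˡ (-‿cong (*-congˡ cs[ζ]≈-ζ^d)) ⟩
      ζ * ev (Vec.init v) - φ l * - (ζ * ζ ^ length cs′)
        ≈⟨ solve 4 (λ z u a p → z :* u :- a :* (:- (z :* p)) := z :* (u :+ p :* a)) refl ζ (ev (Vec.init v)) (φ l) (ζ ^ length cs′) ⟩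
      ζ * (ev (Vec.init v) + ζ ^ length cs′ * φ l)
        ≈⟨ *-congˡ (sym (trans (reflexive (≡.cong ev v≡init∷ʳlast)) (evalV-∷ʳ (Vec.init v) l ζ))) ⟩
      ζ * ev v
        ∎
      where
      cs : List F.Carrier
      cs = c₀ ∷ cs′
      csᵛ : Residue
      csᵛ = Vec.fromList cs
      l : F.Carrier
      l = Vec.last v
      v≡init∷ʳlast : v ≡ Vec.init v Vec.∷ʳ Vec.last v
      v≡init∷ʳlast = proj₂ (proj₂ (Vec.initLast v))
      cs[ζ]≈-ζ^d : evalL cs ζ ≈ - (ζ ^ d)
      cs[ζ]≈-ζ^d = +-inverseʳ-unique (ζ ^ d) (evalL cs ζ) (trans (sym (evalL-monic cs ζ)) ζ-root)

    1ᴿ : Residue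
    1ᴿ = F.1# ∷ 0ᵛ

    ev-1ᴿ : ev 1ᴿ ≈ 1#
    ev-1ᴿ = trans (+-cong φ.1#-homo (trans (*-congˡ (evalV-0ᵛ {length cs′} ζ)) (zeroʳ ζ))) (+-identityʳ 1#)

    infixl 7 _*ᴿ_
    _*ᴿ_ : ∀ {n} → Vec F.Carrier n → Residue → Residue
    [] *ᴿ w = 0ᵛ
    (a ∷ u) *ᴿ w = a *ᵛ w +ᵛ θ· (u *ᴿ w)

    ev-*ᴿ : ∀ {n} (u : Vec F.Carrier n) w → ev (u *ᴿ w) ≈ ev u * ev w
    ev-*ᴿ [] w = trans (evalV-0ᵛ {d} ζ) (sym (zeroˡ _))
    ev-*ᴿ (a ∷ u) w = begin
      ev (a *ᵛ w +ᵛ θ· (u *ᴿ w))      ≈⟨ evalV-+ᵛ (a *ᵛ w) (θ· (u *ᴿ w)) ζ ⟩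
      ev (a *ᵛ w) + ev (θ· (u *ᴿ w))  ≈⟨ +-cong (evalV-*ᵛ a w ζ) (trans (ev-θ· (u *ᴿ w)) (*-congˡ (ev-*ᴿ u w))) ⟩
      φ a * ev w + ζ * (ev u * ev w)  ≈⟨ solve 4 (λ a w z u → a :* w :+ z :* (u :* w) := (a :+ z :* u) :* w) refl (φ a) (ev w) ζ (ev u) ⟩
      (φ a + ζ * ev u) * ev w         ∎

    infixr 8 _^ᴿ_
    _^ᴿ_ : Residue → ℕ → Residue
    v ^ᴿ zero = 1ᴿ
    v ^ᴿ suc e = v *ᴿ v ^ᴿ e

    ev-^ᴿ : ∀ v e → ev (v ^ᴿ e) ≈ ev v ^ e
    ev-^ᴿ v zero = ev-1ᴿ
    ev-^ᴿ v (suc e) = trans (ev-*ᴿ v (v ^ᴿ e)) (*-congˡ (ev-^ᴿ v e))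

    ev-nonzero : ∀ {w} → ¬ w ≈ᵛ 0ᵛ → ¬ ev w ≈ 0#
    ev-nonzero w≉0 ev-w≈0 = w≉0 (ev-injective (trans ev-w≈0 (sym (evalV-0ᵛ {d} ζ))))

    *ᴿ-injective : ∀ {v} → ¬ v ≈ᵛ 0ᵛ → ∀ {x y} → v *ᴿ x ≈ᵛ v *ᴿ y → x ≈ᵛ y
    *ᴿ-injective {v} v≉0 {x} {y} vx≈vy =
      ev-injective (*-cancelˡ (ev-nonzero v≉0) (trans (sym (ev-*ᴿ v x)) (trans (ev-cong vx≈vy) (ev-*ᴿ v y))))

    *ᴿ-nonzero : ∀ {v w} → ¬ v ≈ᵛ 0ᵛ → ¬ w ≈ᵛ 0ᵛ → ¬ v *ᴿ w ≈ᵛ 0ᵛ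
    *ᴿ-nonzero {v} {w} v≉0 w≉0 vw≈0 =
      x*y≉0 (ev-nonzero v≉0) (ev-nonzero w≉0) (trans (sym (ev-*ᴿ v w)) (trans (ev-cong vw≈0) (evalV-0ᵛ {d} ζ)))

    residues : List Residue
    residues = allPolys F elems d

    private
      module ≈ᴿ = Setoid (vecSetoid d)
      module Sum = Reindexing (vecSetoid d) +-commutativeMonoid
      module Product = Reindexing (vecSetoid d) *-commutativeMonoid
      0∈residues : Any (0ᵛ ≈ᵛ_) residues
      0∈residues = allPolys-complete d 0ᵛ

    units : List Residue
    units = residues ─ 0∈residues

    units-nonzero : All (λ w → ¬ w ≈ᵛ 0ᵛ) units
    units-nonzero = All.map (λ w≉0ᴿ w≈0 → w≉0ᴿ (≈ᴿ.trans w≈0 (Any.lookup-result 0∈residues)))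
                            (Sum.─-excludes 0∈residues (allPolys-distinct d))

    ∈-units : ∀ {w} → ¬ w ≈ᵛ 0ᵛ → Any (w ≈ᵛ_) units
    ∈-units {w} w≉0 = Sum.∈-─ 0∈residues (allPolys-complete d w)
                                 (λ w≈0ᴿ → w≉0 (≈ᴿ.trans w≈0ᴿ (≈ᴿ.sym (Any.lookup-result 0∈residues))))

    units-distinct : AllPairs (λ u v → ¬ u ≈ᵛ v) units
    units-distinct = Sum.─-distinct 0∈residues (allPolys-distinct d)

    Q₁ : ℕ
    Q₁ = q ℕ.^ d ∸ 1

    1+|units|≡q^d : suc (length units) ≡ q ℕ.^ d
    1+|units|≡q^d = ≡.trans (≡.sym (List.length-removeAt′ residues (Any.index 0∈residues))) (length-allPolys d)

    |units|≡Q₁ : length units ≡ Q₁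
    |units|≡Q₁ = ≡.cong ℕ.pred 1+|units|≡q^d

    fermat : ∀ {v} → ¬ v ≈ᵛ 0ᵛ → ev v ^ Q₁ ≈ 1#
    fermat {v} v≉0 = *-cancelˡ (Π-nonzero units units-nonzero) (begin
      Π units ev * ev v ^ Q₁               ≈⟨ *-comm _ _ ⟩
      ev v ^ Q₁ * Π units ev               ≈⟨ *-congʳ (reflexive (≡.cong (ev v ^_) (≡.sym |units|≡Q₁))) ⟩
      ev v ^ length units * Π units ev     ≈⟨ sym (Π-scale units) ⟩
      Π units (λ w → ev v * ev w)          ≈⟨ Π-cong units (λ w → sym (ev-*ᴿ v w)) ⟩
      Π units (λ w → ev (v *ᴿ w))          ≈⟨ Product.fold-reindex ev ev-cong (v *ᴿ_) (*ᴿ-injective v≉0) units units-distinct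
                                                (All.map (λ w≉0 → ∈-units (*ᴿ-nonzero v≉0 w≉0)) units-nonzero) ⟩
      Π units ev                           ≈⟨ sym (*-identityʳ _) ⟩
      Π units ev * 1#                      ∎)
      where
      Π : List Residue → (Residue → Carrier) → Carrier
      Π = Product.fold
      Π-cong : ∀ xs {f g : Residue → Carrier} → (∀ x → f x ≈ g x) → Π xs f ≈ Π xs g
      Π-cong [] _ = refl
      Π-cong (x ∷ xs) f≈g = *-cong (f≈g x) (Π-cong xs f≈g)
      Π-scale : ∀ xs → Π xs (λ w → ev v * ev w) ≈ ev v ^ length xs * Π xs ev
      Π-scale [] = sym (*-identityˡ 1#)
      Π-scale (x ∷ xs) = trans (*-congˡ (Π-scale xs))
        (solve 4 (λ k a p b → k :* a :* (p :* b) := k :* p :* (a :* b)) refl (ev v) (ev x) _ _)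
      Π-nonzero : ∀ xs → All (λ w → ¬ w ≈ᵛ 0ᵛ) xs → ¬ Π xs ev ≈ 0#
      Π-nonzero [] [] = 1≉0
      Π-nonzero (x ∷ xs) (x≉0 ∷ xs≉0) = x*y≉0 (ev-nonzero x≉0) (Π-nonzero xs xs≉0)

    Q₁·1≈-1 : Q₁ · 1# ≈ - 1#
    Q₁·1≈-1 = +-inverseʳ-unique 1# (Q₁ · 1#) (begin
      1# + Q₁ · 1#                         ≡⟨ ≡.cong (λ n → 1# + n · 1#) (≡.sym |units|≡Q₁) ⟩
      suc (length units) · 1#              ≡⟨ ≡.cong (_· 1#) 1+|units|≡q^d ⟩
      (q ℕ.* q ℕ.^ length cs′) · 1#        ≈⟨ ×1-homo-* q (q ℕ.^ length cs′) ⟩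
      q · 1# * (q ℕ.^ length cs′) · 1#     ≈⟨ *-congʳ q·1≈0 ⟩
      0# * (q ℕ.^ length cs′) · 1#         ≈⟨ zeroˡ _ ⟩
      0#                                   ∎)

    powerSum : ℕ → Carrier
    powerSum e = Σ residues (λ v → ev v ^ e)

    powerSum≈Σ-units : ∀ e → 1 ≤ e → powerSum e ≈ Σ units (λ v → ev v ^ e)
    powerSum≈Σ-units e@(suc _) _ = begin
      powerSum e                                            ≈⟨ Sum.fold-─ (λ v → ev v ^ e) 0∈residues ⟩
      ev (Any.lookup 0∈residues) ^ e + Σ units _     ≈⟨ +-congʳ (trans (^-congˡ e ev-0≈0) (zeroˡ _)) ⟩
      0# + Σ units (λ v → ev v ^ e)                  ≈⟨ +-identityˡ _ ⟩
      Σ units (λ v → ev v ^ e)                       ∎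
      where
      ev-0≈0 : ev (Any.lookup 0∈residues) ≈ 0#
      ev-0≈0 = trans (ev-cong (≈ᴿ.sym (Any.lookup-result 0∈residues))) (evalV-0ᵛ {d} ζ)

    powerSum[Q₁]≈-1 : 1 ≤ Q₁ → powerSum Q₁ ≈ - 1#
    powerSum[Q₁]≈-1 1≤Q₁ = begin
      powerSum Q₁                         ≈⟨ powerSum≈Σ-units Q₁ 1≤Q₁ ⟩
      Σ units (λ v → ev v ^ Q₁)    ≈⟨ units-fermat units units-nonzero ⟩
      Σ units (λ _ → 1#)           ≈⟨ Σ-const units 1# ⟩
      length units · 1#            ≡⟨ ≡.cong (_· 1#) |units|≡Q₁ ⟩
      Q₁ · 1#                      ≈⟨ Q₁·1≈-1 ⟩
      - 1#                         ∎
      where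
      units-fermat : ∀ ws → All (λ w → ¬ w ≈ᵛ 0ᵛ) ws → Σ ws (λ v → ev v ^ Q₁) ≈ Σ ws (λ _ → 1#)
      units-fermat [] [] = refl
      units-fermat (w ∷ ws) (w≉0 ∷ ws≉0) = +-cong (fermat w≉0) (units-fermat ws ws≉0)

    non-root : ∀ e → 1 ≤ e → e < Q₁ → ∃ λ (v : Residue) → ¬ v ≈ᵛ 0ᵛ × ¬ ev v ^ e ≈ 1#
    non-root e@(suc e′) _ e<Q₁ with All.all? (λ w → (w ^ᴿ e) ≟ᵛ 1ᴿ) units
    ... | yes all-roots = ⊥-elim (ℕ.<⇒≱ e<Q₁ Q₁≤e)
      where
      Q₁≤e : Q₁ ≤ e
      Q₁≤e = ≡.subst (_≤ e) (≡.trans (List.length-map (ev {d}) units) |units|≡Q₁)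
        (PolynomialRoots.roots-of-unity-bound K K-isField e′ (map (ev {d}) units)
          (AllPairs.map⁺ (AllPairs.map (λ u≉v ev≈ → u≉v (ev-injective ev≈)) units-distinct))
          (All.map⁺ (All.map (λ {w} w^e≈1 → trans (sym (ev-^ᴿ w e)) (trans (ev-cong w^e≈1) ev-1ᴿ)) all-roots)))
    ... | no ¬all-roots = Any.lookup w∈ , proj₁ w-facts ,
                          λ ev^e≈1 → proj₂ w-facts (ev-injective (trans (ev-^ᴿ (Any.lookup w∈) e) (trans ev^e≈1 (sym ev-1ᴿ))))
      where
      w∈ : Any (λ w → ¬ (w ^ᴿ e) ≈ᵛ 1ᴿ) units
      w∈ = All.¬All⇒Any¬ (λ w → (w ^ᴿ e) ≟ᵛ 1ᴿ) units ¬all-roots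
      w-facts : ¬ Any.lookup w∈ ≈ᵛ 0ᵛ × ¬ (Any.lookup w∈ ^ᴿ e) ≈ᵛ 1ᴿ
      w-facts = All.lookupAny units-nonzero w∈

    -- Some unit v has ev v ^ e ≠ 1 (there are too few e-th roots of unity), and multiplication
    -- by v permutes the residues while scaling the power sum by ev v ^ e.
    powerSum≈0 : ∀ e → 1 ≤ e → e < Q₁ ℕ.+ Q₁ → e ≢ Q₁ → powerSum e ≈ 0#
    powerSum≈0 e 1≤e e<2Q₁ e≢Q₁ with non-root-power
      where
      non-root-power : ∃ λ (v : Residue) → ¬ v ≈ᵛ 0ᵛ × ¬ ev v ^ e ≈ 1#
      non-root-power with ℕ.<-cmp e Q₁
      ... | tri< e<Q₁ _ _ = non-root e 1≤e e<Q₁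
      ... | tri≈ _ e≡Q₁ _ = ⊥-elim (e≢Q₁ e≡Q₁)
      ... | tri> _ _ Q₁<e with non-root (e ∸ Q₁) (ℕ.m<n⇒0<n∸m Q₁<e)
                                 (≡.subst (e ∸ Q₁ <_) (ℕ.m+n∸m≡n Q₁ Q₁) (ℕ.∸-monoˡ-< e<2Q₁ (ℕ.<⇒≤ Q₁<e)))
      ...   | v , v≉0 , v^[e-Q₁]≉1 = v , v≉0 , λ v^e≈1 → v^[e-Q₁]≉1 (begin
        ev v ^ (e ∸ Q₁)                ≈⟨ sym (*-identityˡ _) ⟩
        1# * ev v ^ (e ∸ Q₁)           ≈⟨ *-congʳ (sym (fermat v≉0)) ⟩
        ev v ^ Q₁ * ev v ^ (e ∸ Q₁)    ≈⟨ sym (^-homo-* (ev v) Q₁ (e ∸ Q₁)) ⟩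
        ev v ^ (Q₁ ℕ.+ (e ∸ Q₁))       ≡⟨ ≡.cong (ev v ^_) (ℕ.m+[n∸m]≡n (ℕ.<⇒≤ Q₁<e)) ⟩
        ev v ^ e                       ≈⟨ v^e≈1 ⟩
        1#                             ∎)
    ... | v , v≉0 , v^e≉1 = x≉1∧xy≈y⇒y≈0 v^e≉1 (begin
      ev v ^ e * powerSum e                              ≈⟨ *-distribˡ-Σ (ev v ^ e) residues _ ⟩
      Σ residues (λ w → ev v ^ e * ev w ^ e)      ≈⟨ Σ-cong residues (λ w → trans (sym (^-distrib-* (ev v) (ev w) e)) (^-congˡ e (sym (ev-*ᴿ v w)))) ⟩
      Σ residues (λ w → ev (v *ᴿ w) ^ e)          ≈⟨ Sum.fold-reindex (λ w → ev w ^ e) (λ w≈ → ^-congˡ e (ev-cong w≈)) (v *ᴿ_) (*ᴿ-injective v≉0)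
                                                       residues (allPolys-distinct d) (All.universal (λ w → allPolys-complete d (v *ᴿ w)) residues) ⟩
      powerSum e                                         ∎)

    -1^Q₁≈1 : (- 1#) ^ Q₁ ≈ 1#
    -1^Q₁≈1 = trans (^-congˡ Q₁ (sym ev[-1]≈-1)) (fermat -1≉0)
      where
      ev[-1]≈-1 : ev (F.- F.1# ∷ 0ᵛ {length cs′}) ≈ - 1#
      ev[-1]≈-1 = trans (+-cong (trans (φ.-‿homo F.1#) (-‿cong φ.1#-homo)) (trans (*-congˡ (evalV-0ᵛ {length cs′} ζ)) (zeroʳ ζ))) (+-identityʳ _)
      -1≉0 : ¬ (F.- F.1# ∷ 0ᵛ) ≈ᵛ 0ᵛ
      -1≉0 -1≈0 = 1≉0 (trans (sym (-‿involutive 1#)) (trans (-‿cong (trans (sym ev[-1]≈-1) (trans (ev-cong -1≈0) (evalV-0ᵛ {d} ζ)))) -0#≈0#))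

    -- Expand (x − v)ᵏ binomially: the i-th term contributes a multiple of powerSum (j + i), and by
    -- powerSum≈0 only i = Q₁ − j survives.
    jacobi-sum : ∀ x j k → 1 ≤ j → j < Q₁ → k < Q₁ →
      Σ residues (λ v → ev v ^ j * (x - ev v) ^ k) ≈
      x ^ ((j ℕ.+ k) % suc (Q₁ ∸ 1)) * ((- 1#) ^ (j ∸ 1) * (k C (Q₁ ∸ j)) · 1#)
    jacobi-sum x j k 1≤j j<Q₁ k<Q₁ = begin
      Σ residues (λ v → ev v ^ j * (x - ev v) ^ k)
        ≈⟨ Σ-cong residues (λ v → binomial-expansion (ev v)) ⟩
      Σ residues (λ v → sum {suc k} (λ i → A (toℕ i) * ev v ^ (j ℕ.+ toℕ i)))
        ≈⟨ Σ-sum-comm {n = suc k} residues (λ v i → A (toℕ i) * ev v ^ (j ℕ.+ toℕ i)) ⟩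
      sum {suc k} (λ i → Σ residues (λ v → A (toℕ i) * ev v ^ (j ℕ.+ toℕ i)))
        ≈⟨ sum-cong-≋ {suc k} (λ i → sym (*-distribˡ-Σ (A (toℕ i)) residues (λ v → ev v ^ (j ℕ.+ toℕ i)))) ⟩
      sum {suc k} (λ i → A (toℕ i) * powerSum (j ℕ.+ toℕ i))
        ≈⟨ single-term ⟩
      x ^ ((j ℕ.+ k) % suc (Q₁ ∸ 1)) * ((- 1#) ^ (j ∸ 1) * (k C m₀) · 1#)
        ∎
      where
      A : ℕ → Carrier
      A i = (k C i) · 1# * ((- 1#) ^ i * x ^ (k ∸ i))

      binomial-expansion : ∀ e → e ^ j * (x - e) ^ k ≈ sum {suc k} (λ i → A (toℕ i) * e ^ (j ℕ.+ toℕ i))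
      binomial-expansion e = begin
        e ^ j * (x - e) ^ k                                  ≈⟨ *-congˡ (trans (^-congˡ k (+-comm x (- e))) (binomial-theorem k (- e) x)) ⟩
        e ^ j * sum {suc k} (binomialTerm (- e) x k)         ≈⟨ *-distribˡ-sum (e ^ j) (binomialTerm (- e) x k) ⟩
        sum {suc k} (λ i → e ^ j * binomialTerm (- e) x k i) ≈⟨ sum-cong-≋ {suc k} (λ i → term (toℕ i)) ⟩
        sum {suc k} (λ i → A (toℕ i) * e ^ (j ℕ.+ toℕ i))    ∎
        where
        term : ∀ i → e ^ j * (k C i) · ((- e) ^ i * x ^ (k ∸ i)) ≈ A i * e ^ (j ℕ.+ i)
        term i = begin
          e ^ j * (k C i) · ((- e) ^ i * x ^ (k ∸ i))
            ≈⟨ *-congˡ (sym (trans (×-assoc-* (k C i) 1# _) (×-congʳ (k C i) (*-identityˡ _)))) ⟩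
          e ^ j * ((k C i) · 1# * ((- e) ^ i * x ^ (k ∸ i)))
            ≈⟨ *-congˡ (*-congˡ (*-congʳ (trans (^-congˡ i (sym (-1*x≈-x e))) (^-distrib-* (- 1#) e i)))) ⟩
          e ^ j * ((k C i) · 1# * ((- 1#) ^ i * e ^ i * x ^ (k ∸ i)))
            ≈⟨ solve 5 (λ a N s b X → a :* (N :* (s :* b :* X)) := N :* (s :* X) :* (a :* b)) refl
                       (e ^ j) ((k C i) · 1#) ((- 1#) ^ i) (e ^ i) (x ^ (k ∸ i)) ⟩
          A i * (e ^ j * e ^ i)
            ≈⟨ *-congˡ (sym (^-homo-* e j i)) ⟩
          A i * e ^ (j ℕ.+ i)
            ∎

      m₀ : ℕ
      m₀ = Q₁ ∸ j
      j+m₀≡Q₁ : j ℕ.+ m₀ ≡ Q₁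
      j+m₀≡Q₁ = ℕ.m+[n∸m]≡n (ℕ.<⇒≤ j<Q₁)

      vanishing-term : ∀ (i : Fin (suc k)) → j ℕ.+ toℕ i ≢ Q₁ → A (toℕ i) * powerSum (j ℕ.+ toℕ i) ≈ 0#
      vanishing-term i j+i≢Q₁ = trans (*-congˡ (powerSum≈0 (j ℕ.+ toℕ i) (ℕ.≤-trans 1≤j (ℕ.m≤m+n j _))
        (ℕ.+-mono-< j<Q₁ (ℕ.≤-<-trans (ℕ.≤-pred (toℕ<n i)) k<Q₁)) j+i≢Q₁)) (zeroʳ _)

      single-term : sum {suc k} (λ i → A (toℕ i) * powerSum (j ℕ.+ toℕ i)) ≈
                    x ^ ((j ℕ.+ k) % suc (Q₁ ∸ 1)) * ((- 1#) ^ (j ∸ 1) * (k C m₀) · 1#)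
      single-term with m₀ ℕ.≤? k
      ... | yes m₀≤k = begin
        sum {suc k} (λ i → A (toℕ i) * powerSum (j ℕ.+ toℕ i))      ≈⟨ sum-single _ i₀ (λ i i≢i₀ → vanishing-term i (i≢i₀ ∘ toℕ≡m₀⇒≡i₀ i)) ⟩
        A (toℕ i₀) * powerSum (j ℕ.+ toℕ i₀)                        ≡⟨ ≡.cong (λ i → A i * powerSum (j ℕ.+ i)) (toℕ-fromℕ< (s≤s m₀≤k)) ⟩
        A m₀ * powerSum (j ℕ.+ m₀)                                  ≈⟨ *-congˡ (trans (reflexive (≡.cong powerSum j+m₀≡Q₁)) (powerSum[Q₁]≈-1 1≤Q₁)) ⟩
        (k C m₀) · 1# * ((- 1#) ^ m₀ * x ^ (k ∸ m₀)) * - 1#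
          ≈⟨ solve 4 (λ N s X o → N :* (s :* X) :* o := X :* (s :* o :* N)) refl ((k C m₀) · 1#) ((- 1#) ^ m₀) (x ^ (k ∸ m₀)) (- 1#) ⟩
        x ^ (k ∸ m₀) * ((- 1#) ^ m₀ * - 1# * (k C m₀) · 1#)
          ≈⟨ *-cong (reflexive (≡.cong (x ^_) (≡.sym ([j+k]%Q≡k∸[Q∸j] Q₁ j<Q₁ m₀≤k k<Q₁))))
                    (*-congʳ (-1^m*-1≈-1^[j∸1] Q₁ -1^Q₁≈1 j m₀ 1≤j j+m₀≡Q₁)) ⟩
        x ^ ((j ℕ.+ k) % suc (Q₁ ∸ 1)) * ((- 1#) ^ (j ∸ 1) * (k C m₀) · 1#) ∎
        where
        i₀ : Fin (suc k)
        i₀ = fromℕ< (s≤s m₀≤k)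
        toℕ≡m₀⇒≡i₀ : ∀ i → j ℕ.+ toℕ i ≡ Q₁ → i ≡ i₀
        toℕ≡m₀⇒≡i₀ i j+i≡Q₁ =
          toℕ-injective (≡.trans (ℕ.+-cancelˡ-≡ j _ _ (≡.trans j+i≡Q₁ (≡.sym j+m₀≡Q₁))) (≡.sym (toℕ-fromℕ< (s≤s m₀≤k))))
        1≤Q₁ : 1 ≤ Q₁
        1≤Q₁ = ℕ.≤-trans 1≤j (ℕ.<⇒≤ j<Q₁)
      ... | no m₀≰k = begin
        sum {suc k} (λ i → A (toℕ i) * powerSum (j ℕ.+ toℕ i))      ≈⟨ sum-zero _ (λ i → vanishing-term i (ℕ.<⇒≢ (j+i<Q₁ i))) ⟩
        0#                                                   ≈⟨ sym (trans (*-congˡ (trans (*-congˡ kCm₀≈0) (zeroʳ _))) (zeroʳ _)) ⟩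
        x ^ ((j ℕ.+ k) % suc (Q₁ ∸ 1)) * ((- 1#) ^ (j ∸ 1) * (k C m₀) · 1#) ∎
        where
        j+i<Q₁ : ∀ (i : Fin (suc k)) → j ℕ.+ toℕ i < Q₁
        j+i<Q₁ i = ≡.subst (j ℕ.+ toℕ i <_) j+m₀≡Q₁ (ℕ.+-monoʳ-< j (ℕ.≤-<-trans (ℕ.≤-pred (toℕ<n i)) (ℕ.≰⇒> m₀≰k)))
        kCm₀≈0 : (k C m₀) · 1# ≈ 0#
        kCm₀≈0 = reflexive (≡.cong (_· 1#) (k>n⇒nCk≡0 (ℕ.≰⇒> m₀≰k)))

    Σ-affine : ∀ {m} (α : Vec F.Carrier m) (β : List F.Carrier) → ¬ evalL β ζ ≈ 0# →
               (g : Carrier → Carrier) → Congruent₁ g →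
               Σ residues (λ v → g (ev α + evalL β ζ * ev v)) ≈ Σ residues (λ v → g (ev v))
    Σ-affine α β β[ζ]≉0 g g-cong = begin
      Σ residues (λ v → g (ev α + evalL β ζ * ev v)) ≈⟨ Σ-cong residues (λ v → g-cong (sym (ev-h v))) ⟩
      Σ residues (λ v → g (ev (h v)))                ≈⟨ Sum.fold-reindex (λ v → g (ev v)) (λ v≈w → g-cong (ev-cong v≈w)) h h-injective
                                                          residues (allPolys-distinct d) (All.universal (λ v → allPolys-complete d (h v)) residues) ⟩
      Σ residues (λ v → g (ev v))                    ∎
      where
      h : Residue → Residue
      h v = α *ᴿ 1ᴿ +ᵛ Vec.fromList β *ᴿ v
      ev-h : ∀ v → ev (h v) ≈ ev α + evalL β ζ * ev v
      ev-h v = trans (evalV-+ᵛ (α *ᴿ 1ᴿ) (Vec.fromList β *ᴿ v) ζ)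
                     (+-cong (trans (ev-*ᴿ α 1ᴿ) (trans (*-congˡ ev-1ᴿ) (*-identityʳ _)))
                             (trans (ev-*ᴿ (Vec.fromList β) v) (*-congʳ (evalV-fromList β ζ))))
      h-injective : ∀ {v w} → h v ≈ᵛ h w → v ≈ᵛ w
      h-injective {v} {w} hv≈hw = ev-injective (*-cancelˡ β[ζ]≉0 (+-cancelˡ (ev α) _ _
        (trans (sym (ev-h v)) (trans (ev-cong hv≈hw) (ev-h w)))))

  private
    P : (n : ℕ) → List (Vec F.Carrier n)
    P = allPolys F elems

  Σ-allPolys-∷ : ∀ n (f : Vec F.Carrier (suc n) → Carrier) → Σ (P (suc n)) f ≈ Σ elems (λ x → Σ (P n) (λ a → f (x ∷ a)))
  Σ-allPolys-∷ n f = trans (Σ-concatMap elems (λ x → map (x ∷_) (P n)) f) (Σ-cong elems (λ x → Σ-map (P n) (x ∷_) f))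

  Σ-allPolys-∷ʳ : ∀ n (f : Vec F.Carrier (suc n) → Carrier) → Σ (P n) (λ t → Σ elems (λ x → f (t Vec.∷ʳ x))) ≈ Σ (P (suc n)) f
  Σ-allPolys-∷ʳ zero f = trans (+-identityʳ _) (sym (trans (Σ-allPolys-∷ zero f) (Σ-cong elems (λ _ → +-identityʳ _))))
  Σ-allPolys-∷ʳ (suc n) f = begin
    Σ (P (suc n)) (λ t → Σ elems (λ x → f (t Vec.∷ʳ x)))                   ≈⟨ Σ-allPolys-∷ n _ ⟩
    Σ elems (λ y → Σ (P n) (λ t → Σ elems (λ x → f (y ∷ (t Vec.∷ʳ x)))))   ≈⟨ Σ-cong elems (λ y → Σ-allPolys-∷ʳ n (λ a → f (y ∷ a))) ⟩
    Σ elems (λ y → Σ (P (suc n)) (λ a → f (y ∷ a)))                        ≈⟨ sym (Σ-allPolys-∷ (suc n) f) ⟩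
    Σ (P (suc (suc n))) f                                                  ∎

  Σ-allPolys-cast : ∀ {m n} (m≡n : m ≡ n) (h : Vec F.Carrier n → Carrier) →
                    Σ (P n) h ≈ Σ (P m) (λ a → h (≡.subst (Vec F.Carrier) m≡n a))
  Σ-allPolys-cast ≡.refl h = refl

  evalV-cast : ∀ {m n} (m≡n : m ≡ n) (a : Vec F.Carrier m) z → evalV (≡.subst (Vec F.Carrier) m≡n a) z ≈ evalV a z
  evalV-cast ≡.refl a z = refl

  +ᵛ-cancelʳ : ∀ {n} {u u′ t : Vec F.Carrier n} → u +ᵛ t ≈ᵛ u′ +ᵛ t → u ≈ᵛ u′
  +ᵛ-cancelʳ {u = []} {[]} {[]} Pointwise.[] = Pointwise.[]
  +ᵛ-cancelʳ {u = a ∷ u} {b ∷ u′} {x ∷ t} (a+x≈b+x Pointwise.∷ rest) = F.+-cancelʳ x a b a+x≈b+x Pointwise.∷ +ᵛ-cancelʳ rest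

  Σ-allPolys-translate : ∀ n (G : Vec F.Carrier n → Carrier) → (∀ {u v} → u ≈ᵛ v → G u ≈ G v) →
                         ∀ t → Σ (P n) (λ u → G (u +ᵛ t)) ≈ Σ (P n) G
  Σ-allPolys-translate n G G-cong t = Reindexing.fold-reindex (vecSetoid n) +-commutativeMonoid G G-cong (_+ᵛ t) +ᵛ-cancelʳ
    (P n) (allPolys-distinct n) (All.universal (λ u → allPolys-complete n (u +ᵛ t)) (P n))

  module Decomposition (c₀ : F.Carrier) (cs′ : List F.Carrier) where
    private
      open Pointwise using ([]; _∷_)
      d : ℕ
      d = suc (length cs′)
      csᵛ : Vec F.Carrier d
      csᵛ = Vec.fromList (c₀ ∷ cs′)

    -- u +𝔭· w is u + 𝔭 w for 𝔭 = monic (c₀ ∷ cs′); the recursion peels off the constant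
    -- term, using u + w₀ 𝔭 = (u + w₀ csᵛ) + w₀ θᵈ.
    infixl 6 _+𝔭·_
    _+𝔭·_ : ∀ {n} → Vec F.Carrier d → Vec F.Carrier n → Vec F.Carrier (n ℕ.+ d)
    u +𝔭· [] = u
    u +𝔭· (w₀ ∷ w) = Vec.head (u +ᵛ w₀ *ᵛ csᵛ) ∷ (Vec.tail (u +ᵛ w₀ *ᵛ csᵛ) Vec.∷ʳ w₀) +𝔭· w

    private
      head-cong : ∀ {n} {v v′ : Vec F.Carrier (suc n)} → v ≈ᵛ v′ → Vec.head v F.≈ Vec.head v′
      head-cong (x≈y ∷ _) = x≈y
      tail-cong : ∀ {n} {v v′ : Vec F.Carrier (suc n)} → v ≈ᵛ v′ → Vec.tail v ≈ᵛ Vec.tail v′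
      tail-cong (_ ∷ t≈t′) = t≈t′
      ∷ʳ-congˡ : ∀ {n} {t t′ : Vec F.Carrier n} x → t ≈ᵛ t′ → (t Vec.∷ʳ x) ≈ᵛ (t′ Vec.∷ʳ x)
      ∷ʳ-congˡ x [] = F.refl ∷ []
      ∷ʳ-congˡ x (x≈y ∷ t≈t′) = x≈y ∷ ∷ʳ-congˡ x t≈t′
      +ᵛ-congˡ : ∀ {n} {u u′ : Vec F.Carrier n} t → u ≈ᵛ u′ → u +ᵛ t ≈ᵛ u′ +ᵛ t
      +ᵛ-congˡ [] [] = []
      +ᵛ-congˡ (x ∷ t) (a≈b ∷ u≈u′) = F.+-congʳ a≈b ∷ +ᵛ-congˡ t u≈u′

    +𝔭·-congˡ : ∀ {n} {u u′ : Vec F.Carrier d} (w : Vec F.Carrier n) → u ≈ᵛ u′ → u +𝔭· w ≈ᵛ u′ +𝔭· w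
    +𝔭·-congˡ [] u≈u′ = u≈u′
    +𝔭·-congˡ {u = u} {u′} (w₀ ∷ w) u≈u′ = head-cong v≈v′ ∷ +𝔭·-congˡ w (∷ʳ-congˡ w₀ (tail-cong v≈v′))
      where
      v≈v′ : u +ᵛ w₀ *ᵛ csᵛ ≈ᵛ u′ +ᵛ w₀ *ᵛ csᵛ
      v≈v′ = +ᵛ-congˡ (w₀ *ᵛ csᵛ) u≈u′

    evalV-+𝔭· : ∀ {n} (u : Vec F.Carrier d) (w : Vec F.Carrier n) z →
                evalV (u +𝔭· w) z ≈ evalV u z + evalL (monic F (c₀ ∷ cs′)) z * evalV w z
    evalV-+𝔭· u [] z = sym (trans (+-congˡ (zeroʳ _)) (+-identityʳ _))
    evalV-+𝔭· u (w₀ ∷ w) z with u +ᵛ w₀ *ᵛ csᵛ in v≡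
    ... | h ∷ t = begin
      φ h + z * evalV ((t Vec.∷ʳ w₀) +𝔭· w) z
        ≈⟨ +-congˡ (*-congˡ (evalV-+𝔭· (t Vec.∷ʳ w₀) w z)) ⟩
      φ h + z * (evalV (t Vec.∷ʳ w₀) z + 𝔭[z] * evalV w z)
        ≈⟨ +-congˡ (*-congˡ (+-congʳ (evalV-∷ʳ t w₀ z))) ⟩
      φ h + z * ((evalV t z + z ^ length cs′ * φ w₀) + 𝔭[z] * evalV w z)
        ≈⟨ solve 6 (λ h z t p a r → h :+ z :* ((t :+ p :* a) :+ r) := (h :+ z :* t) :+ (z :* p :* a :+ z :* r)) refl
                   (φ h) z (evalV t z) (z ^ length cs′) (φ w₀) (𝔭[z] * evalV w z) ⟩
      (φ h + z * evalV t z) + (z ^ d * φ w₀ + z * (𝔭[z] * evalV w z))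
        ≈⟨ +-congʳ u+w₀cs[z] ⟩
      (evalV u z + φ w₀ * E) + (z ^ d * φ w₀ + z * (𝔭[z] * evalV w z))
        ≈⟨ +-congˡ (+-congˡ (*-congˡ (*-congʳ 𝔭[z]≈))) ⟩
      (evalV u z + φ w₀ * E) + (z ^ d * φ w₀ + z * ((z ^ d + E) * evalV w z))
        ≈⟨ solve 6 (λ U a E p z W → (U :+ a :* E) :+ (p :* a :+ z :* ((p :+ E) :* W)) := U :+ (p :+ E) :* (a :+ z :* W)) refl
                   (evalV u z) (φ w₀) E (z ^ d) z (evalV w z) ⟩
      evalV u z + (z ^ d + E) * (φ w₀ + z * evalV w z)
        ≈⟨ +-congˡ (*-congʳ (sym 𝔭[z]≈)) ⟩
      evalV u z + 𝔭[z] * (φ w₀ + z * evalV w z)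
        ∎
      where
      𝔭[z] E : Carrier
      𝔭[z] = evalL (monic F (c₀ ∷ cs′)) z
      E = evalL (c₀ ∷ cs′) z
      𝔭[z]≈ : 𝔭[z] ≈ z ^ d + E
      𝔭[z]≈ = evalL-monic (c₀ ∷ cs′) z
      u+w₀cs[z] : φ h + z * evalV t z ≈ evalV u z + φ w₀ * E
      u+w₀cs[z] = trans (reflexive (≡.cong (λ v → evalV v z) (≡.sym v≡)))
                        (trans (evalV-+ᵛ u (w₀ *ᵛ csᵛ) z) (+-congˡ (trans (evalV-*ᵛ w₀ csᵛ z) (*-congˡ (evalV-fromList (c₀ ∷ cs′) z)))))

    Σ-decomposition : ∀ n (h : Vec F.Carrier (n ℕ.+ d) → Carrier) → (∀ {a b} → a ≈ᵛ b → h a ≈ h b) →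
                      Σ (P (n ℕ.+ d)) h ≈ Σ (P d) (λ u → Σ (P n) (λ w → h (u +𝔭· w)))
    Σ-decomposition zero h h-cong = Σ-cong (P d) (λ u → sym (+-identityʳ _))
    Σ-decomposition (suc n) h h-cong = begin
      Σ (P (suc n ℕ.+ d)) h
        ≈⟨ Σ-allPolys-∷ (n ℕ.+ d) h ⟩
      Σ elems (λ x → Σ (P (n ℕ.+ d)) (λ a → h (x ∷ a)))
        ≈⟨ Σ-cong elems (λ x → Σ-decomposition n (λ a → h (x ∷ a)) (λ a≈b → h-cong (F.refl ∷ a≈b))) ⟩
      Σ elems (λ x → Σ (P d) (G x))
        ≈⟨ Σ-cong elems (λ x → sym (Σ-allPolys-∷ʳ (length cs′) (G x))) ⟩
      Σ elems (λ x → Σ (P d′) (λ t → Σ elems (λ w₀ → G x (t Vec.∷ʳ w₀)))) ≈⟨ Σ-cong elems (λ x → Σ-comm (P d′) elems (λ t w₀ → G x (t Vec.∷ʳ w₀))) ⟩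
      Σ elems (λ x → Σ elems (λ w₀ → Σ (P d′) (λ t → G x (t Vec.∷ʳ w₀)))) ≈⟨ Σ-comm elems elems (λ x w₀ → Σ (P d′) (λ t → G x (t Vec.∷ʳ w₀))) ⟩
      Σ elems (λ w₀ → Σ elems (λ x → Σ (P d′) (λ t → G x (t Vec.∷ʳ w₀)))) ≈⟨ Σ-cong elems (λ w₀ → sym (Σ-allPolys-∷ d′ (Φ w₀))) ⟩
      Σ elems (λ w₀ → Σ (P d) (Φ w₀))
        ≈⟨ Σ-cong elems (λ w₀ → sym (Σ-allPolys-translate d (Φ w₀) (Φ-cong w₀) (w₀ *ᵛ csᵛ))) ⟩
      Σ elems (λ w₀ → Σ (P d) (λ u → Φ w₀ (u +ᵛ w₀ *ᵛ csᵛ)))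
        ≈⟨ sym (Σ-comm (P d) elems (λ u w₀ → Φ w₀ (u +ᵛ w₀ *ᵛ csᵛ))) ⟩
      Σ (P d) (λ u → Σ elems (λ w₀ → Φ w₀ (u +ᵛ w₀ *ᵛ csᵛ)))
        ≈⟨ Σ-cong (P d) (λ u → sym (Σ-allPolys-∷ n (λ w → h (u +𝔭· w)))) ⟩
      Σ (P d) (λ u → Σ (P (suc n)) (λ w → h (u +𝔭· w)))
        ∎
      where
      d′ : ℕ
      d′ = length cs′
      G : F.Carrier → Vec F.Carrier d → Carrier
      G x y = Σ (P n) (λ w → h (x ∷ y +𝔭· w))
      Φ : F.Carrier → Vec F.Carrier d → Carrier
      Φ w₀ v = G (Vec.head v) (Vec.tail v Vec.∷ʳ w₀)
      Φ-cong : ∀ w₀ {v v′} → v ≈ᵛ v′ → Φ w₀ v ≈ Φ w₀ v′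
      Φ-cong w₀ v≈v′ = Σ-cong (P n) (λ w → h-cong (head-cong v≈v′ ∷ +𝔭·-congˡ w (∷ʳ-congˡ w₀ (tail-cong v≈v′))))

  evalSum : ℕ → Carrier → (Carrier → Carrier) → Carrier
  evalSum n z g = Σ (P n) (λ v → g (evalV v z))

  Σ-affine-invariant : ∀ cs → MonicIrreducible F cs → ∀ ζ → evalL (monic F cs) ζ ≈ 0# →
                       ∀ {m} (α : Vec F.Carrier m) (β : List F.Carrier) → ¬ evalL β ζ ≈ 0# → ∀ g → Congruent₁ g →
                       evalSum (length cs) ζ (λ x → g (evalV α ζ + evalL β ζ * x)) ≈ evalSum (length cs) ζ g
  Σ-affine-invariant [] (() , _)
  Σ-affine-invariant (c₀ ∷ cs′) cs-irreducible ζ ζ-root = ResidueField.Σ-affine c₀ cs′ cs-irreducible ζ ζ-root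

  jacobi-sum : ∀ cs → MonicIrreducible F cs → ∀ ζ → evalL (monic F cs) ζ ≈ 0# → ∀ x j k →
               1 ≤ j × j < q ℕ.^ length cs ∸ 1 → 1 ≤ k × k < q ℕ.^ length cs ∸ 1 →
               evalSum (length cs) ζ (λ y → pow y j * pow (x - y) k) ≈
               pow x ((j ℕ.+ k) % suc (q ℕ.^ length cs ∸ 1 ∸ 1)) * (pow (- 1#) (j ∸ 1) * natK (k C (q ℕ.^ length cs ∸ 1 ∸ j)))
  jacobi-sum [] (() , _)
  jacobi-sum cs@(c₀ ∷ cs′) cs-irreducible ζ ζ-root x j k (1≤j , j<Q₁) (_ , k<Q₁) = begin
    evalSum (length cs) ζ (λ y → pow y j * pow (x - y) k)   ≈⟨ Σ-cong (P (length cs)) (λ v → reflexive (≡.cong₂ _*_ (pow≡^ _ j) (pow≡^ _ k))) ⟩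
    evalSum (length cs) ζ (λ y → y ^ j * (x - y) ^ k)       ≈⟨ ResidueField.jacobi-sum c₀ cs′ cs-irreducible ζ ζ-root x j k 1≤j j<Q₁ k<Q₁ ⟩
    x ^ e * ((- 1#) ^ (j ∸ 1) * n · 1#)                     ≡⟨ ≡.sym (≡.cong₂ _*_ (pow≡^ x e) (≡.cong₂ _*_ (pow≡^ (- 1#) (j ∸ 1)) (natK≡·1 n))) ⟩
    pow x e * (pow (- 1#) (j ∸ 1) * natK n)                 ∎
    where
    e n : ℕ
    e = (j ℕ.+ k) % suc (q ℕ.^ length cs ∸ 1 ∸ 1)
    n = k C (q ℕ.^ length cs ∸ 1 ∸ j)

  factorization-step : ∀ cs → MonicIrreducible F cs → ∀ ζ₀ → evalL (monic F cs) ζ₀ ≈ 0# →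
    ∀ {r} (𝔭 : Fin r → List F.Carrier) (ζ : Fin r → Carrier) →
    (∀ i → MonicIrreducible F (𝔭 i)) → (∀ i → evalL (monic F (𝔭 i)) (ζ i) ≈ 0#) →
    (∀ i → ¬ evalL (monic F cs) (ζ i) ≈ 0#) →
    ∀ N → (g₀ : Carrier → Carrier) → Congruent₁ g₀ → (g : Fin r → Carrier → Carrier) → (∀ i → Congruent₁ (g i)) →
    (∀ (h : Fin r → Carrier → Carrier) → (∀ i → Congruent₁ (h i)) →
       Σ (P N) (λ w → prodFin r (λ i → h i (evalV w (ζ i)))) ≈ prodFin r (λ i → evalSum (length (𝔭 i)) (ζ i) (h i))) →
    Σ (P (length cs ℕ.+ N)) (λ a → g₀ (evalV a ζ₀) * prodFin r (λ i → g i (evalV a (ζ i)))) ≈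
    evalSum (length cs) ζ₀ g₀ * prodFin r (λ i → evalSum (length (𝔭 i)) (ζ i) (g i))
  factorization-step [] (() , _)
  factorization-step cs@(c₀ ∷ cs′) _ ζ₀ ζ₀-root {r} 𝔭 ζ 𝔭-irreducible ζ-roots ζ-not-roots N g₀ g₀-cong g g-cong
                     factorization-rest = begin
    Σ (P (d ℕ.+ N)) H
      ≈⟨ Σ-allPolys-cast N+d≡d+N H ⟩
    Σ (P (N ℕ.+ d)) (λ a → H (≡.subst (Vec F.Carrier) N+d≡d+N a))
      ≈⟨ Σ-cong (P (N ℕ.+ d)) (λ a → H-cong-eval (≡.subst (Vec F.Carrier) N+d≡d+N a) a (evalV-cast N+d≡d+N a)) ⟩
    Σ (P (N ℕ.+ d)) H
      ≈⟨ Σ-decomposition N H (λ {a} {b} a≈b → H-cong-eval a b (λ z → evalV-cong z a≈b)) ⟩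
    Σ (P d) (λ u → Σ (P N) (λ w → H (u +𝔭· w)))
      ≈⟨ Σ-cong (P d) (λ u → Σ-cong (P N) (λ w → H[u+𝔭w] u w)) ⟩
    Σ (P d) (λ u → Σ (P N) (λ w → g₀ (evalV u ζ₀) * prodFin r (λ i → h u i (evalV w (ζ i)))))
      ≈⟨ Σ-cong (P d) (λ u → sym (*-distribˡ-Σ (g₀ (evalV u ζ₀)) (P N) _)) ⟩
    Σ (P d) (λ u → g₀ (evalV u ζ₀) * Σ (P N) (λ w → prodFin r (λ i → h u i (evalV w (ζ i)))))
      ≈⟨ Σ-cong (P d) (λ u → *-congˡ (factorization-rest (h u) (h-cong u))) ⟩
    Σ (P d) (λ u → g₀ (evalV u ζ₀) * prodFin r (λ i → evalSum (length (𝔭 i)) (ζ i) (h u i)))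
      ≈⟨ Σ-cong (P d) (λ u → *-congˡ (prodFin-cong r (λ i → translation-invariant u i))) ⟩
    Σ (P d) (λ u → g₀ (evalV u ζ₀) * prodFin r (λ i → evalSum (length (𝔭 i)) (ζ i) (g i)))
      ≈⟨ sym (*-distribʳ-Σ _ (P d) (λ u → g₀ (evalV u ζ₀))) ⟩
    evalSum d ζ₀ g₀ * prodFin r (λ i → evalSum (length (𝔭 i)) (ζ i) (g i))
      ∎
    where
    open Decomposition c₀ cs′
    d : ℕ
    d = length cs
    N+d≡d+N : N ℕ.+ d ≡ d ℕ.+ N
    N+d≡d+N = ℕ.+-comm N d
    H : ∀ {m} → Vec F.Carrier m → Carrier
    H a = g₀ (evalV a ζ₀) * prodFin r (λ i → g i (evalV a (ζ i)))
    H-cong-eval : ∀ {m n} (a : Vec F.Carrier m) (b : Vec F.Carrier n) → (∀ z → evalV a z ≈ evalV b z) → H a ≈ H b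
    H-cong-eval a b a≈b = *-cong (g₀-cong (a≈b ζ₀)) (prodFin-cong r (λ i → g-cong i (a≈b (ζ i))))
    h : Vec F.Carrier d → Fin r → Carrier → Carrier
    h u i x = g i (evalV u (ζ i) + evalL (monic F cs) (ζ i) * x)
    h-cong : ∀ u i → Congruent₁ (h u i)
    h-cong u i x≈y = g-cong i (+-congˡ (*-congˡ x≈y))
    H[u+𝔭w] : ∀ u (w : Vec F.Carrier N) → H (u +𝔭· w) ≈ g₀ (evalV u ζ₀) * prodFin r (λ i → h u i (evalV w (ζ i)))
    H[u+𝔭w] u w = *-cong (g₀-cong (trans (evalV-+𝔭· u w ζ₀) (trans (+-congˡ (trans (*-congʳ ζ₀-root) (zeroˡ _))) (+-identityʳ _))))
                         (prodFin-cong r (λ i → g-cong i (evalV-+𝔭· u w (ζ i))))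
    translation-invariant : ∀ u i → evalSum (length (𝔭 i)) (ζ i) (h u i) ≈ evalSum (length (𝔭 i)) (ζ i) (g i)
    translation-invariant u i = Σ-affine-invariant (𝔭 i) (𝔭-irreducible i) (ζ i) (ζ-roots i) u (monic F cs) (ζ-not-roots i) (g i) (g-cong i)

  factorization : ∀ r (𝔭 : Fin r → List F.Carrier) (ζ : Fin r → Carrier) →
    (∀ i → MonicIrreducible F (𝔭 i)) → (∀ i l → i ≢ l → ¬ 𝔭 i ≋ 𝔭 l) → (∀ i → evalL (monic F (𝔭 i)) (ζ i) ≈ 0#) →
    (g : Fin r → Carrier → Carrier) → (∀ i → Congruent₁ (g i)) →
    Σ (P (sumℕ r (λ i → length (𝔭 i)))) (λ a → prodFin r (λ i → g i (evalV a (ζ i)))) ≈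
    prodFin r (λ i → evalSum (length (𝔭 i)) (ζ i) (g i))
  factorization zero 𝔭 ζ _ _ _ g _ = +-identityʳ 1#
  factorization (suc r) 𝔭 ζ 𝔭-irreducible 𝔭-distinct ζ-roots g g-cong =
    factorization-step (𝔭 fzero) (𝔭-irreducible fzero) (ζ fzero) (ζ-roots fzero)
      (λ i → 𝔭 (fsuc i)) (λ i → ζ (fsuc i)) (λ i → 𝔭-irreducible (fsuc i)) (λ i → ζ-roots (fsuc i))
      (λ i → RootOfIrreducible.not-root-of-other-irreducible (𝔭 (fsuc i)) (𝔭-irreducible (fsuc i)) (ζ (fsuc i)) (ζ-roots (fsuc i))
               (𝔭 fzero) (𝔭-irreducible fzero) (𝔭-distinct fzero (fsuc i) (λ ())))
      (sumℕ r (λ i → length (𝔭 (fsuc i)))) (g fzero) (g-cong fzero) (λ i → g (fsuc i)) (λ i → g-cong (fsuc i))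
      (factorization r (λ i → 𝔭 (fsuc i)) (λ i → ζ (fsuc i)) (λ i → 𝔭-irreducible (fsuc i))
                       (λ i l i≢l → 𝔭-distinct (fsuc i) (fsuc l) (λ i≡l → i≢l (fsuc-injective i≡l))) (λ i → ζ-roots (fsuc i)))

-- Imported only here: inside the modules above, _+_ and _^_ are the ring operations.
open import Data.Nat using (_+_; _^_)

lemma2p4 : ∀ {c ℓ c′ ℓ′ : Level}
  -- the finite field F_q, q = length elems
  (F : CommutativeRing c ℓ) → IsField F →
  (elems : List (CommutativeRing.Carrier F)) → IsEnumeration F elems →
  -- the field receiving the character values (C_∞ in the paper)
  (K : CommutativeRing c′ ℓ′) → IsField K →
  (φ : CommutativeRing.Carrier F → CommutativeRing.Carrier K) →
  RingMorphisms.IsRingHomomorphism (CommutativeRing.rawRing F) (CommutativeRing.rawRing K) φ →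
  -- distinct monic irreducibles 𝔭 i (non-leading coefficients), deg 𝔭 i = length (𝔭 i)
  (r : ℕ) → (𝔭 : Fin r → List (CommutativeRing.Carrier F)) →
  (∀ i → MonicIrreducible F (𝔭 i)) →
  (∀ i l → i ≢ l → ¬ (_≈P_ F (𝔭 i) (𝔭 l))) →
  -- ζ i a root of 𝔭 i
  (ζ : Fin r → CommutativeRing.Carrier K) →
  (∀ i → CommutativeRing._≈_ K
           (CommutativeRing._+_ K (Eval.pow F K φ (ζ i) (length (𝔭 i))) (Eval.evalL F K φ (𝔭 i) (ζ i)))
           (CommutativeRing.0# K)) →
  (j k : Fin r → ℕ) →
  (∀ i → 1 ≤ j i × j i < length elems ^ length (𝔭 i) ∸ 1) →
  (∀ i → 1 ≤ k i × k i < length elems ^ length (𝔭 i) ∸ 1) →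
  -- δ ranges over polynomials with deg δ < deg 𝔫 = Σ deg 𝔭 i
  (δ : Vec (CommutativeRing.Carrier F) (sumℕ r (λ i → length (𝔭 i)))) →
  CommutativeRing._≈_ K
    (Eval.sumL F K φ
      (map (λ a → CommutativeRing._*_ K (Eval.χ F K φ r ζ j a) (Eval.χ F K φ r ζ k (subV F δ a)))
           (allPolys F elems (sumℕ r (λ i → length (𝔭 i))))))
    (CommutativeRing._*_ K
      (Eval.χ F K φ r ζ (λ i → (j i + k i) % suc (length elems ^ length (𝔭 i) ∸ 1 ∸ 1)) δ)
      (Eval.prodFin F K φ r (λ i →
         CommutativeRing._*_ K
           (Eval.pow F K φ (CommutativeRing.-_ K (CommutativeRing.1# K)) (j i ∸ 1))
           (Eval.natK F K φ (k i C (length elems ^ length (𝔭 i) ∸ 1 ∸ j i))))))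
lemma2p4 F F-isField elems elems-enumeration K K-isField φ φ-isHomomorphism r 𝔭 𝔭-irreducible 𝔭-distinct ζ ζ-roots j k j-bounds k-bounds δ = begin
  Σ (allPolys F elems N) (λ a → χ r ζ j a * χ r ζ k (subV F δ a))      ≈⟨ Σ-cong (allPolys F elems N) character-product ⟩
  Σ (allPolys F elems N) (λ a → prodFin r (λ i → g i (evalV a (ζ i)))) ≈⟨ factorization r 𝔭 ζ 𝔭-irreducible 𝔭-distinct 𝔭-roots g g-cong ⟩
  prodFin r (λ i → evalSum (length (𝔭 i)) (ζ i) (g i))                  ≈⟨ prodFin-cong r jacobi-sums ⟩
  prodFin r (λ i → pow (δ[ζ] i) (e i) * sign i)                         ≈⟨ prodFin-distrib-* r _ sign ⟩
  χ r ζ e δ * prodFin r sign                                            ∎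
  where
  open CommutativeRing K hiding (_+_)
  open Eval F K φ
  open Evaluation F K φ φ-isHomomorphism using (prodFin-cong; prodFin-distrib-*; pow-congˡ; evalV-subV; monic-root)
  open ListSum K using (Σ; Σ-cong)
  open FiniteFieldSums F F-isField elems elems-enumeration K K-isField φ φ-isHomomorphism using (evalSum; factorization; jacobi-sum)
  open import Relation.Binary.Reasoning.Setoid setoid
  N : ℕ
  N = sumℕ r (λ i → length (𝔭 i))
  Q₁ e : Fin r → ℕ
  Q₁ i = length elems ^ length (𝔭 i) ∸ 1
  e i = (j i + k i) % suc (Q₁ i ∸ 1)
  δ[ζ] sign : Fin r → Carrier
  δ[ζ] i = evalV δ (ζ i)
  sign i = pow (- 1#) (j i ∸ 1) * natK (k i C (Q₁ i ∸ j i))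
  g : Fin r → Carrier → Carrier
  g i y = pow y (j i) * pow (δ[ζ] i - y) (k i)
  g-cong : ∀ i {x y} → x ≈ y → g i x ≈ g i y
  g-cong i x≈y = *-cong (pow-congˡ (j i) x≈y) (pow-congˡ (k i) (+-congˡ (-‿cong x≈y)))
  𝔭-roots : ∀ i → evalL (monic F (𝔭 i)) (ζ i) ≈ 0#
  𝔭-roots i = monic-root (𝔭 i) (ζ i) (ζ-roots i)
  character-product : ∀ a → χ r ζ j a * χ r ζ k (subV F δ a) ≈ prodFin r (λ i → g i (evalV a (ζ i)))
  character-product a = trans (sym (prodFin-distrib-* r _ _)) (prodFin-cong r (λ i → *-congˡ (pow-congˡ (k i) (evalV-subV δ a (ζ i)))))
  jacobi-sums : ∀ i → evalSum (length (𝔭 i)) (ζ i) (g i) ≈ pow (δ[ζ] i) (e i) * sign i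
  jacobi-sums i = jacobi-sum (𝔭 i) (𝔭-irreducible i) (ζ i) (𝔭-roots i) (δ[ζ] i) (j i) (k i) (j-bounds i) (k-bounds i)
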